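{- Let $G=(V_1,V_2,E)$ be an undirected bipartite graph on $n$ vertices with $|V_1|=|V_2|=n/2$, and fix $s\in V_1$. Work in the polynomial ring over $GF(2)$ in variables $x_{uv}$, one for each ordered pair $(u,v)$ with $uv\in E$, subject to the identification $x_{uv}=x_{vu}$ whenever $u\neq s$ and $v\neq s$. For distinct $u,v\in V_1$ let $N(u,v)=\{w\in V_2: uw\in E,\ wv\in E\}$. Let $D=(V_1,F)$ be the directed graph whose arc set $F$ contains both $uv$ and $vu$ for every pair of distinct $u,v\in V_1$ with $N(u,v)\neq\emptyset$. Define $f:F\times(2^{V_2}\setminus\{\emptyset\})\to GF(2)[x]$ by $f(uv,\{w\})=x_{uw}x_{wv}$ for $uv\in F$ and $w\in N(u,v)$, and $f=0$ at all other points. Then (I) $\Lambda(D,V_2,f)=\sum_{H\in hc(G)}\prod_{uv\in H}x_{uv}$; and (II) $\Lambda(D,V_2,f)$ is the zero polynomial if and only if $hc(G)=\emptyset$.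
   Context: For a directed graph $D=(V,A)$, a cycle cover is a subset $C\subseteq A$ such that every vertex is the start of exactly one arc of $C$ and the end of exactly one arc of $C$; $cc(D)$ is the set of cycle covers. The Labeled Cycle Cover Sum for a finite label set $L$ and $f:A\times(2^L\setminus\{\emptyset\})\to R$ is \[\Lambda(D,L,f)=\sum_{C\in cc(D)}\ \sum_{g:L\twoheadrightarrow C}\ \prod_{a\in C} f(a,g^{ -1}(a)),\] where $g$ ranges over surjections and $g^{ -1}(a)=\{\ell\in L:g(\ell)=a\}$. For an undirected graph $G$, $hc(G)$ denotes the set of oriented Hamiltonian cycles, i.e. each Hamiltonian cycle counted once for each of its two traversal directions; for $H\in hc(G)$, "$uv\in H$" ranges over the arcs of $H$ oriented in the traversal direction. -}

module Defs where

open import Data.Bool using (Bool; true; false; _∧_; _∨_; not; if_then_else_; T)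
open import Data.Nat using (ℕ; zero; suc; _+_; _≤ᵇ_; _%_)
open import Data.Fin using (Fin; _≟_)
open import Data.Fin.Subset using (Subset)
open import Data.Vec using (Vec; []; _∷_; lookup)
open import Data.List using (List; []; _∷_; _++_; map; concatMap; foldr; allFin; filterᵇ; length; cartesianProduct)
open import Data.Bool.ListAction using (and; or)
open import Data.Product using (_×_; _,_; proj₁; proj₂)
open import Data.Sum using (_⊎_; inj₁; inj₂; [_,_])
open import Relation.Nullary.Decidable using (⌊_⌋)
open import Relation.Binary.PropositionalEquality using (_≡_)
import Data.Sum.Properties as SumP
import Data.Product.Properties as ProdP

allVecs : {A : Set} → List A → (m : ℕ) → List (Vec A m)
allVecs xs zero    = [] ∷ []
allVecs xs (suc m) = concatMap (λ x → map (x ∷_) (allVecs xs m)) xs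

allFunsFin : {A : Set} → List A → (m : ℕ) → List (Fin m → A)
allFunsFin xs m = map lookup (allVecs xs m)

allBool : List Bool
allBool = true ∷ false ∷ []

allᵇ : {A : Set} → List A → (A → Bool) → Bool
allᵇ xs p = and (map p xs)

anyᵇ : {A : Set} → List A → (A → Bool) → Bool
anyᵇ xs p = or (map p xs)

countᵇ : {A : Set} → List A → (A → Bool) → ℕ
countᵇ xs p = length (filterᵇ p xs)

finEq : {k : ℕ} → Fin k → Fin k → Bool
finEq i j = ⌊ i ≟ j ⌋

-- A monomial is an exponent function X → ℕ; a polynomial is
-- a formal sum (list) of monomials, coefficients being taken mod 2.
-- This is the free GF(2)-vector space on monomials, i.e. GF(2)[X].

Monomial : Set → Set
Monomial X = X → ℕ

module Poly (X : Set) (allX : List X) (_≟X_ : X → X → Bool) where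

  monoEq : Monomial X → Monomial X → Bool
  monoEq m m' = allᵇ allX (λ x → ⌊ m x Data.Nat.≟ m' x ⌋)

  Pol : Set
  Pol = List (Monomial X)

  0ₚ : Pol
  0ₚ = []

  1ₚ : Pol
  1ₚ = (λ _ → 0) ∷ []

  var : X → Pol
  var x = (λ y → if x ≟X y then 1 else 0) ∷ []

  _+ₚ_ : Pol → Pol → Pol
  p +ₚ q = p ++ q

  _*ₚ_ : Pol → Pol → Pol
  p *ₚ q = concatMap (λ m → map (λ m' x → m x + m' x) q) p

  coeff : Monomial X → Pol → ℕ
  coeff m p = countᵇ p (monoEq m) % 2

  _≈ₚ_ : Pol → Pol → Set
  p ≈ₚ q = (m : Monomial X) → coeff m p ≡ coeff m q

  Σₚ : {A : Set} → List A → (A → Pol) → Pol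
  Σₚ xs f = foldr (λ a acc → f a +ₚ acc) 0ₚ xs

  Πₚ : {A : Set} → List A → (A → Pol) → Pol
  Πₚ xs f = foldr (λ a acc → f a *ₚ acc) 1ₚ xs

  -- Labeled Cycle Cover Sum Λ(D, L, f) for a digraph D on vertex set
  -- Fin k with arc set A ⊆ Fin k × Fin k (Boolean adjacency), label set
  -- L = Fin m, and f : (arc) × (subset of L) → GF(2)[X].
  -- (f is only ever evaluated at arcs of A and nonempty label sets.)

  module _ (k : ℕ) where

    Arc : Set
    Arc = Fin k × Fin k

    allArcs : List Arc
    allArcs = cartesianProduct (allFin k) (allFin k)

    arcEq : Arc → Arc → Bool
    arcEq (u , v) (u' , v') = finEq u u' ∧ finEq v v'

    allArcSets : List (Arc → Bool)
    allArcSets = map (λ χ a → lookup χ (Data.Fin.combine (proj₁ a) (proj₂ a)))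
                     (allVecs allBool (Data.Nat._*_ k k))

    isCycleCover : (Arc → Bool) → (Arc → Bool) → Bool
    isCycleCover A C =
      allᵇ allArcs (λ a → not (C a) ∨ A a)
      ∧ allᵇ (allFin k) (λ u → ⌊ countᵇ (allFin k) (λ v → C (u , v)) Data.Nat.≟ 1 ⌋)
      ∧ allᵇ (allFin k) (λ v → ⌊ countᵇ (allFin k) (λ u → C (u , v)) Data.Nat.≟ 1 ⌋)

    cc : (Arc → Bool) → List (Arc → Bool)
    cc A = filterᵇ (isCycleCover A) allArcSets

    isSurjOnto : {m : ℕ} → (Arc → Bool) → (Fin m → Arc) → Bool
    isSurjOnto {m} C g =
      allᵇ (allFin m) (λ l → C (g l))
      ∧ allᵇ allArcs (λ a → not (C a) ∨ anyᵇ (allFin m) (λ l → arcEq (g l) a))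

    surj : (m : ℕ) → (Arc → Bool) → List (Fin m → Arc)
    surj m C = filterᵇ (isSurjOnto C) (allFunsFin allArcs m)

    preimage : {m : ℕ} → (Fin m → Arc) → Arc → Subset m
    preimage {m} g a = Data.Vec.tabulate (λ l → arcEq (g l) a)

    Λ : (A : Arc → Bool) (m : ℕ) (f : Arc → Subset m → Pol) → Pol
    Λ A m f =
      Σₚ (cc A) (λ C →
        Σₚ (surj m C) (λ g →
          Πₚ (filterᵇ C allArcs) (λ a → f a (preimage g a))))

-- The setting of the lemma: bipartite G = (V₁, V₂, E), |V₁| = |V₂| = k,
-- n = k + k vertices, V₁ = V₂ = Fin k, E given by adj u w (u ∈ V₁, w ∈ V₂).

-- Variables x_{uv}, after the identification x_{uv} = x_{vu} for u,v ≠ s: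
-- (false , u , w) stands for x_{uw} (u ∈ V₁, w ∈ V₂), and also for x_{wu}
-- when u ≠ s; (true , s , w) stands for x_{ws}.
Var : ℕ → Set
Var k = Bool × Fin k × Fin k

allVar : (k : ℕ) → List (Var k)
allVar k = concatMap (λ b → concatMap (λ u → map (λ w → b , u , w) (allFin k)) (allFin k)) allBool

varEq : {k : ℕ} → Var k → Var k → Bool
varEq (b , u , w) (b' , u' , w') =
  ⌊ b Data.Bool.≟ b' ⌋ ∧ finEq u u' ∧ finEq w w'

module GF2 (k : ℕ) = Poly (Var k) (allVar k) varEq

Vtx : ℕ → Set
Vtx k = Fin k ⊎ Fin k

allVtx : (k : ℕ) → List (Vtx k)
allVtx k = map inj₁ (allFin k) ++ map inj₂ (allFin k)

vtxEq : {k : ℕ} → Vtx k → Vtx k → Bool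
vtxEq u v = ⌊ SumP.≡-dec _≟_ _≟_ u v ⌋

edge : {k : ℕ} → (Fin k → Fin k → Bool) → Vtx k → Vtx k → Bool
edge adj (inj₁ u) (inj₂ w) = adj u w
edge adj (inj₂ w) (inj₁ u) = adj u w
edge adj (inj₁ _) (inj₁ _) = false
edge adj (inj₂ _) (inj₂ _) = false

-- the variable x_{uv} for an ordered pair (u,v) with uv ∈ E
-- (non-edges never occur; they are sent to 0)
x : {k : ℕ} → (s : Fin k) → Vtx k → Vtx k → GF2.Pol k
x {k} s (inj₁ u) (inj₂ w) = GF2.var k (false , u , w)
x {k} s (inj₂ w) (inj₁ u) =
  if finEq u s then GF2.var k (true , u , w) else GF2.var k (false , u , w)
x {k} s (inj₁ _) (inj₁ _) = GF2.0ₚ k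
x {k} s (inj₂ _) (inj₂ _) = GF2.0ₚ k

allVtxFuns : (k : ℕ) → List (Vtx k → Vtx k)
allVtxFuns k = concatMap (λ f₁ → map (λ f₂ → [ f₁ , f₂ ]) (allFunsFin (allVtx k) k))
                         (allFunsFin (allVtx k) k)

iter : {A : Set} → (A → A) → ℕ → A → A
iter σ zero    a = a
iter σ (suc i) a = σ (iter σ i a)

-- An oriented Hamiltonian cycle H of G, given by its successor map σ
-- (uv ∈ H iff v = σ u): length n = k + k ≥ 3, every (v , σ v) is an edge,
-- and the σ-orbit of a base vertex has exactly n elements, closing up.
isHam : {k : ℕ} → (Fin k → Fin k → Bool) → Fin k → (Vtx k → Vtx k) → Bool
isHam {k} adj s σ =
  (3 ≤ᵇ (k + k))
  ∧ allᵇ (allVtx k) (λ v → edge adj v (σ v))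
  ∧ allᵇ (allVtx k) (λ v → anyᵇ (Data.List.upTo (k + k)) (λ i → vtxEq (iter σ i (inj₁ s)) v))
  ∧ vtxEq (iter σ (k + k) (inj₁ s)) (inj₁ s)

hc : {k : ℕ} → (Fin k → Fin k → Bool) → Fin k → List (Vtx k → Vtx k)
hc {k} adj s = filterᵇ (isHam adj s) (allVtxFuns k)

hamSum : {k : ℕ} → (Fin k → Fin k → Bool) → Fin k → GF2.Pol k
hamSum {k} adj s =
  GF2.Σₚ k (hc adj s) (λ σ → GF2.Πₚ k (allVtx k) (λ v → x s v (σ v)))

inN : {k : ℕ} → (Fin k → Fin k → Bool) → Fin k → Fin k → Fin k → Bool
inN adj u v w = adj u w ∧ adj v w

arcF : {k : ℕ} → (Fin k → Fin k → Bool) → Fin k × Fin k → Bool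
arcF {k} adj (u , v) = not (finEq u v) ∧ anyᵇ (allFin k) (inN adj u v)

isSingleton : {k : ℕ} → Subset k → Fin k → Bool
isSingleton {k} S w = allᵇ (allFin k) (λ w' → ⌊ lookup S w' Data.Bool.≟ finEq w' w ⌋)

fLab : {k : ℕ} → (Fin k → Fin k → Bool) → Fin k → Fin k × Fin k → Subset k → GF2.Pol k
fLab {k} adj s (u , v) S =
  GF2.Σₚ k (allFin k) (λ w →
    if arcF adj (u , v) ∧ inN adj u v w ∧ isSingleton S w
    then GF2._*ₚ_ k (x s (inj₁ u) (inj₂ w)) (x s (inj₂ w) (inj₁ v))
    else GF2.0ₚ k)

ΛG : {k : ℕ} → (Fin k → Fin k → Bool) → Fin k → GF2.Pol k
ΛG {k} adj s = GF2.Λ k k (arcF adj) k (fLab adj s)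

module Submission where

-- Polynomials are formal lists of monomials, equal when every monomial m
-- occurs equally often mod 2; so everything is proved by counting, for a
-- fixed m, the occurrences of m on both sides.
--
--  * Expanding Λ(D, V₂, f): a pair (C, g) contributes only when every label
--    w ∈ V₂ is the unique preimage of its arc g w = (γ w , β w); then γ and β
--    are bijections V₂ → V₁, w ∈ N(γ w, β w), and the contribution is the
--    single monomial ∏_w x_{γ w, w} x_{w, β w}.  Such g are "good labelings"
--    and the count of m in Λ is the number of good labelings with monomial m.
--  * An oriented Hamiltonian cycle with successor map σ is the same thing as
--    a good labeling whose permutation ν = γ⁻¹ ∘ β of V₂ is one cycle (a
--    "Hamiltonian labeling"), with the same monomial.
--  * A good non-Hamiltonian labeling has a ν-cycle avoiding γ⁻¹(s); swapping
--    γ and β on the first such cycle is a fixed-point-free involution which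
--    keeps the monomial, because x_{uw} = x_{wu} away from s.  These terms
--    cancel mod 2, giving (I).
--  * A Hamiltonian labeling is determined by its monomial (its cycle can be
--    read off from s, where the variables are not symmetrised), so every
--    Hamiltonian cycle contributes a monomial of coefficient 1, giving (II).

open import Defs
open import Data.Nat using (ℕ; zero; suc; _+_; _*_; _∸_; _≤_; _<_; z≤n; s≤s; _<?_; _≤ᵇ_; _%_; _/_)
open import Data.Nat.Properties
open import Data.Nat.DivMod using (m≡m%n+[m/n]*n; m%n<n; [m+kn]%n≡m%n)
open import Data.Bool using (Bool; true; false; _∧_; _∨_; not; if_then_else_; T)
import Data.Bool.Properties as BP
open import Data.List using (List; []; _∷_; _++_; map; concatMap; foldr; allFin; filterᵇ; cartesianProduct; upTo)
import Data.List as L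
import Data.List.Properties as LP
open import Data.List.Membership.Propositional using (_∈_)
open import Data.List.Membership.Propositional.Properties using (∈-upTo⁺; ∈-upTo⁻; ∈-allFin; ∈-map⁺; ∈-concat⁺′)
open import Data.List.Relation.Unary.Any using (here; there)
open import Data.Fin using (Fin; zero; suc; toℕ; fromℕ<; punchOut; combine; remQuot)
import Data.Fin.Properties as FP
open import Data.Vec using (Vec; []; _∷_; lookup; tabulate)
import Data.Vec.Properties as VP
import Data.Sum.Properties as SumP
open import Data.Product using (_×_; _,_; proj₁; proj₂; Σ; ∃-syntax; swap)
open import Data.Sum using (_⊎_; inj₁; inj₂; [_,_])
open import Data.Empty using (⊥; ⊥-elim)
open import Relation.Binary using (tri<; tri≈; tri>)
open import Relation.Binary.PropositionalEquality hiding ([_])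
open import Relation.Nullary using (Dec; yes; no; ¬_)
open import Relation.Nullary.Decidable using (⌊_⌋)
open import Function.Bundles using (_⇔_; mk⇔; Equivalence)

infixr 7 _⊙_
_⊙_ : Bool → ℕ → ℕ
true ⊙ n = n
false ⊙ n = 0

∑ : {A : Set} → List A → (A → ℕ) → ℕ
∑ [] f = 0
∑ (a ∷ l) f = f a + ∑ l f

∑-0 : {A : Set} (l : List A) {f : A → ℕ} → (∀ a → f a ≡ 0) → ∑ l f ≡ 0
∑-0 [] e = refl
∑-0 (a ∷ l) e rewrite e a = ∑-0 l e

module _ {A : Set} where
  ∑-cong : (l : List A) {f g : A → ℕ} → (∀ a → f a ≡ g a) → ∑ l f ≡ ∑ l g
  ∑-cong [] e = refl
  ∑-cong (a ∷ l) e = cong₂ _+_ (e a) (∑-cong l e)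

  ∑-+ : (l : List A) (f g : A → ℕ) → ∑ l (λ a → f a + g a) ≡ ∑ l f + ∑ l g
  ∑-+ [] f g = refl
  ∑-+ (a ∷ l) f g rewrite ∑-+ l f g = +-assoc-lemma (f a) (g a) (∑ l f) (∑ l g)
    where
    +-assoc-lemma : ∀ p q r t → p + q + (r + t) ≡ p + r + (q + t)
    +-assoc-lemma p q r t = begin
        p + q + (r + t) ≡⟨ +-assoc p q (r + t) ⟩
        p + (q + (r + t)) ≡⟨ cong (p +_) (sym (+-assoc q r t)) ⟩
        p + (q + r + t) ≡⟨ cong (λ z → p + (z + t)) (+-comm q r) ⟩
        p + (r + q + t) ≡⟨ cong (p +_) (+-assoc r q t) ⟩
        p + (r + (q + t)) ≡⟨ sym (+-assoc p r (q + t)) ⟩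
        p + r + (q + t) ∎
      where open ≡-Reasoning

  ∑-* : (l : List A) (c : ℕ) (f : A → ℕ) → ∑ l (λ a → c * f a) ≡ c * ∑ l f
  ∑-* [] c f = sym (*-zeroʳ c)
  ∑-* (a ∷ l) c f rewrite ∑-* l c f = sym (*-distribˡ-+ c (f a) (∑ l f))

  ∑-++ : (l1 l2 : List A) (f : A → ℕ) → ∑ (l1 ++ l2) f ≡ ∑ l1 f + ∑ l2 f
  ∑-++ [] l2 f = refl
  ∑-++ (a ∷ l1) l2 f rewrite ∑-++ l1 l2 f = sym (+-assoc (f a) (∑ l1 f) (∑ l2 f))

  ∑-filter : (l : List A) (p : A → Bool) (f : A → ℕ) → ∑ (filterᵇ p l) f ≡ ∑ l (λ a → p a ⊙ f a)
  ∑-filter [] p f = refl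
  ∑-filter (a ∷ l) p f with p a
  ... | true = cong (f a +_) (∑-filter l p f)
  ... | false = ∑-filter l p f

  ∑-mono : (l : List A) {f g : A → ℕ} → (∀ a → f a ≤ g a) → ∑ l f ≤ ∑ l g
  ∑-mono [] e = z≤n
  ∑-mono (a ∷ l) e = +-mono-≤ (e a) (∑-mono l e)

  ∑-⊙ : (l : List A) (b : Bool) (f : A → ℕ) → ∑ l (λ a → b ⊙ f a) ≡ b ⊙ ∑ l f
  ∑-⊙ l true f = refl
  ∑-⊙ l false f = ∑-0 l (λ _ → refl)

  count-∑ : (l : List A) (p : A → Bool) → countᵇ l p ≡ ∑ l (λ a → p a ⊙ 1)
  count-∑ [] p = refl
  count-∑ (a ∷ l) p with p a
  ... | true = cong suc (count-∑ l p)
  ... | false = count-∑ l p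

∑-map : {A B : Set} (l : List A) (h : A → B) (f : B → ℕ) → ∑ (map h l) f ≡ ∑ l (λ a → f (h a))
∑-map [] h f = refl
∑-map (a ∷ l) h f = cong (f (h a) +_) (∑-map l h f)

module _ {A B : Set} where
  ∑-concatMap : (l : List A) (h : A → List B) (f : B → ℕ) → ∑ (concatMap h l) f ≡ ∑ l (λ a → ∑ (h a) f)
  ∑-concatMap [] h f = refl
  ∑-concatMap (a ∷ l) h f = trans (∑-++ (h a) (concatMap h l) f) (cong (∑ (h a) f +_) (∑-concatMap l h f))

  ∑-swap : (l1 : List A) (l2 : List B) (h : A → B → ℕ) → ∑ l1 (λ a → ∑ l2 (λ b → h a b)) ≡ ∑ l2 (λ b → ∑ l1 (λ a → h a b))
  ∑-swap [] l2 h = sym (∑-0 l2 (λ _ → refl))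
  ∑-swap (a ∷ l1) l2 h = trans (cong (∑ l2 (h a) +_) (∑-swap l1 l2 h)) (sym (∑-+ l2 (h a) (λ b → ∑ l1 (λ a' → h a' b))))

  ∑-cart : (l1 : List A) (l2 : List B) (f : A × B → ℕ) → ∑ (cartesianProduct l1 l2) f ≡ ∑ l1 (λ a → ∑ l2 (λ b → f (a , b)))
  ∑-cart [] l2 f = refl
  ∑-cart (a ∷ l1) l2 f = trans (∑-++ (map (a ,_) l2) _ f) (cong₂ _+_ (∑-map l2 (a ,_) f) (∑-cart l1 l2 f))

⊙-0 : (b : Bool) → b ⊙ 0 ≡ 0
⊙-0 true = refl
⊙-0 false = refl

⊙-∧ : (a b : Bool) (c : ℕ) → (a ∧ b) ⊙ c ≡ a ⊙ b ⊙ c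
⊙-∧ true b c = refl
⊙-∧ false b c = refl

⊙-+ : ∀ c m n → c ⊙ m + c ⊙ n ≡ c ⊙ (m + n)
⊙-+ true m n = refl
⊙-+ false m n = refl

∑-tabulate : {A : Set} (n : ℕ) (h : Fin n → A) (f : A → ℕ) → ∑ (L.tabulate h) f ≡ ∑ (allFin n) (λ i → f (h i))
∑-tabulate zero h f = refl
∑-tabulate (suc n) h f = cong (f (h zero) +_) (trans (∑-tabulate n (λ i → h (suc i)) f) (sym (∑-tabulate n suc (λ i → f (h i)))))

∑-allFin-suc : (n : ℕ) (f : Fin (suc n) → ℕ) → ∑ (allFin (suc n)) f ≡ f zero + ∑ (allFin n) (λ i → f (suc i))
∑-allFin-suc n f = cong (f zero +_) (∑-tabulate n suc f)

dec-sound : {P : Set} (d : Dec P) → ⌊ d ⌋ ≡ true → P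
dec-sound (yes p) _ = p
dec-sound (no _) ()

dec-complete : {P : Set} (d : Dec P) → P → ⌊ d ⌋ ≡ true
dec-complete (yes p) _ = refl
dec-complete (no ¬p) p = ⊥-elim (¬p p)

dec-false : {P : Set} (d : Dec P) → ¬ P → ⌊ d ⌋ ≡ false
dec-false (yes p) ¬p = ⊥-elim (¬p p)
dec-false (no _) _ = refl

t≢f : true ≢ false
t≢f ()

∧-true₁ : {a b : Bool} → (a ∧ b) ≡ true → a ≡ true
∧-true₁ {true} e = refl

∧-true₂ : {a b : Bool} → (a ∧ b) ≡ true → b ≡ true
∧-true₂ {true} e = e

∧-intro : {a b : Bool} → a ≡ true → b ≡ true → (a ∧ b) ≡ true
∧-intro refl refl = refl

bool-iff : {a b : Bool} → (a ≡ true → b ≡ true) → (b ≡ true → a ≡ true) → a ≡ b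
bool-iff {true} {true} f g = refl
bool-iff {true} {false} f g = sym (f refl)
bool-iff {false} {true} f g = g refl
bool-iff {false} {false} f g = refl

not-true : {a : Bool} → not a ≡ true → a ≡ false
not-true {false} _ = refl

∨-elim-not : {a b : Bool} → (not a ∨ b) ≡ true → a ≡ true → b ≡ true
∨-elim-not {true} e refl = e

not∨-false : {a b : Bool} → (not a ∨ b) ≡ false → a ≡ true × b ≡ false
not∨-false {true} {false} _ = refl , refl

∧t-false : {a b : Bool} → b ≡ true → (a ∧ b) ≡ false → a ≡ false
∧t-false {false} _ _ = refl
∧t-false {true} refl ()

bool-case : {A : Set} (b : Bool) → (b ≡ true → A) → (b ≡ false → A) → A
bool-case true f g = f refl
bool-case false f g = g refl

record Enum (A : Set) : Set where
  field
    eq : A → A → Bool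
    eq-sound : ∀ {a b} → eq a b ≡ true → a ≡ b
    eq-refl : ∀ a → eq a a ≡ true
    list : List A
    uniq : ∀ a → ∑ list (λ b → eq a b ⊙ 1) ≡ 1

  eq-false : ∀ {a b} → a ≢ b → eq a b ≡ false
  eq-false {a} {b} ne with eq a b in e
  ... | true = ⊥-elim (ne (eq-sound e))
  ... | false = refl

  delta : (a : A) (F : A → ℕ) → ∑ list (λ b → eq a b ⊙ F b) ≡ F a
  delta a F = begin
      ∑ list (λ b → eq a b ⊙ F b) ≡⟨ ∑-cong list scale ⟩
      ∑ list (λ b → F a * (eq a b ⊙ 1)) ≡⟨ ∑-* list (F a) _ ⟩
      F a * ∑ list (λ b → eq a b ⊙ 1) ≡⟨ cong (F a *_) (uniq a) ⟩
      F a * 1 ≡⟨ *-identityʳ (F a) ⟩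
      F a ∎
    where
    open ≡-Reasoning
    scale : ∀ b → eq a b ⊙ F b ≡ F a * (eq a b ⊙ 1)
    scale b with eq a b in e
    ... | true rewrite eq-sound e = sym (*-identityʳ (F b))
    ... | false = sym (*-zeroʳ (F a))

open Enum

mem : {A : Set} (E : Enum A) (a : A) → a ∈ list E
mem {A} E a = go (list E) (uniq E a)
  where
  go : (l : List A) → ∑ l (λ b → eq E a b ⊙ 1) ≡ 1 → a ∈ l
  go [] ()
  go (b ∷ l) h with eq E a b in e
  ... | true = here (eq-sound E e)
  ... | false = there (go l h)

module _ {A₁ A₂ : Set} (E₁ : Enum A₁) (E₂ : Enum A₂) where
  ∑-bijection : (P : A₁ → Bool) (Q : A₂ → Bool) (F₁ : A₁ → ℕ) (F₂ : A₂ → ℕ)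
        (φ : A₁ → A₂) (ψ : A₂ → A₁) →
        (∀ a → P a ≡ true → Q (φ a) ≡ true) →
        (∀ b → Q b ≡ true → P (ψ b) ≡ true) →
        (∀ a → P a ≡ true → ψ (φ a) ≡ a) →
        (∀ b → Q b ≡ true → φ (ψ b) ≡ b) →
        (∀ a → P a ≡ true → F₁ a ≡ F₂ (φ a)) →
        ∑ (list E₁) (λ a → P a ⊙ F₁ a) ≡ ∑ (list E₂) (λ b → Q b ⊙ F₂ b)
  ∑-bijection P Q F₁ F₂ φ ψ PQ QP ψφ φψ FF = begin
      ∑ (list E₁) (λ a → P a ⊙ F₁ a)
        ≡⟨ ∑-cong (list E₁) (λ a → sym (delta E₂ (φ a) (λ _ → P a ⊙ F₁ a))) ⟩
      ∑ (list E₁) (λ a → ∑ (list E₂) (λ b → eq E₂ (φ a) b ⊙ P a ⊙ F₁ a))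
        ≡⟨ ∑-swap (list E₁) (list E₂) _ ⟩
      ∑ (list E₂) (λ b → ∑ (list E₁) (λ a → eq E₂ (φ a) b ⊙ P a ⊙ F₁ a))
        ≡⟨ ∑-cong (list E₂) (λ b → ∑-cong (list E₁) (λ a → pair a b)) ⟩
      ∑ (list E₂) (λ b → ∑ (list E₁) (λ a → eq E₁ (ψ b) a ⊙ Q b ⊙ F₂ b))
        ≡⟨ ∑-cong (list E₂) (λ b → delta E₁ (ψ b) (λ _ → Q b ⊙ F₂ b)) ⟩
      ∑ (list E₂) (λ b → Q b ⊙ F₂ b) ∎
    where
    open ≡-Reasoning
    pair : ∀ a b → eq E₂ (φ a) b ⊙ P a ⊙ F₁ a ≡ eq E₁ (ψ b) a ⊙ Q b ⊙ F₂ b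
    pair a b with P a in ep | eq E₂ (φ a) b in e2
    ... | true | true rewrite sym (eq-sound E₂ e2) | PQ a ep | ψφ a ep | eq-refl E₁ a = FF a ep
    ... | true | false with eq E₁ (ψ b) a in e1 | Q b in eq'
    ... | true | true = ⊥-elim (t≢f (trans (sym (subst (λ z → eq E₂ z b ≡ true)
                          (sym (trans (cong φ (sym (eq-sound E₁ e1))) (φψ b eq'))) (eq-refl E₂ b))) e2))
    ... | true | false = refl
    ... | false | _ = refl
    pair a b | false | e with eq E₁ (ψ b) a in e1 | Q b in eq'
    ... | true | true = ⊥-elim (t≢f (trans (sym (subst (λ z → P z ≡ true) (eq-sound E₁ e1) (QP b eq'))) ep))
    ... | true | false = ⊙-0 e
    ... | false | _ = ⊙-0 e

finEq-refl : {k : ℕ} (i : Fin k) → finEq i i ≡ true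
finEq-refl i = dec-complete (i Data.Fin.≟ i) refl

finEq-sound : {k : ℕ} {i j : Fin k} → finEq i j ≡ true → i ≡ j
finEq-sound {i = i} {j} = dec-sound (i Data.Fin.≟ j)

finEq-false : {k : ℕ} {i j : Fin k} → i ≢ j → finEq i j ≡ false
finEq-false {i = i} {j} = dec-false (i Data.Fin.≟ j)

finEq-sym : {k : ℕ} (a b : Fin k) → finEq a b ≡ finEq b a
finEq-sym a b = bool-iff (λ e → subst (λ z → finEq z a ≡ true) (finEq-sound e) (finEq-refl a))
                         (λ e → subst (λ z → finEq z b ≡ true) (finEq-sound e) (finEq-refl b))

finEq-suc : {k : ℕ} (a b : Fin k) → finEq (suc a) (suc b) ≡ finEq a b
finEq-suc a b with a Data.Fin.≟ b
... | yes _ = refl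
... | no _ = refl

EFin-uniq : (k : ℕ) (i : Fin k) → ∑ (allFin k) (λ j → finEq i j ⊙ 1) ≡ 1
EFin-uniq (suc n) zero = trans (∑-allFin-suc n (λ j → finEq zero j ⊙ 1)) (cong suc (∑-0 (allFin n) (λ _ → refl)))
EFin-uniq (suc n) (suc i) = trans (∑-allFin-suc n (λ j → finEq (suc i) j ⊙ 1))
  (trans (∑-cong (allFin n) (λ j → cong (_⊙ 1) (finEq-suc i j))) (EFin-uniq n i))

EFin : (k : ℕ) → Enum (Fin k)
EFin k = record { eq = finEq ; eq-sound = finEq-sound ; eq-refl = finEq-refl ; list = allFin k ; uniq = EFin-uniq k }

EBool : Enum Bool
EBool = record { eq = λ a b → ⌊ a Data.Bool.≟ b ⌋ ; eq-sound = λ {a} {b} → dec-sound (a Data.Bool.≟ b)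
               ; eq-refl = λ a → dec-complete (a Data.Bool.≟ a) refl ; list = allBool ; uniq = once }
  where
  once : ∀ a → ∑ allBool (λ b → ⌊ a Data.Bool.≟ b ⌋ ⊙ 1) ≡ 1
  once true = refl
  once false = refl

module _ {A B : Set} (E₁ : Enum A) (E₂ : Enum B) where
  EProd : Enum (A × B)
  EProd = record { eq = λ p q → eq E₁ (proj₁ p) (proj₁ q) ∧ eq E₂ (proj₂ p) (proj₂ q)
                 ; eq-sound = sound ; eq-refl = λ p → rf p ; list = cartesianProduct (list E₁) (list E₂) ; uniq = once }
    where
    sound : ∀ {p q : A × B} → (eq E₁ (proj₁ p) (proj₁ q) ∧ eq E₂ (proj₂ p) (proj₂ q)) ≡ true → p ≡ q
    sound {p} {q} e with eq E₁ (proj₁ p) (proj₁ q) in e1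
    ... | true = cong₂ _,_ (eq-sound E₁ e1) (eq-sound E₂ e)
    ... | false = ⊥-elim (t≢f (sym e))
    rf : ∀ p → (eq E₁ (proj₁ p) (proj₁ p) ∧ eq E₂ (proj₂ p) (proj₂ p)) ≡ true
    rf p rewrite eq-refl E₁ (proj₁ p) = eq-refl E₂ (proj₂ p)
    once : ∀ p → ∑ (cartesianProduct (list E₁) (list E₂)) (λ q → (eq E₁ (proj₁ p) (proj₁ q) ∧ eq E₂ (proj₂ p) (proj₂ q)) ⊙ 1) ≡ 1
    once (a , b) = begin
        _ ≡⟨ ∑-cart (list E₁) (list E₂) _ ⟩
        ∑ (list E₁) (λ a' → ∑ (list E₂) (λ b' → (eq E₁ a a' ∧ eq E₂ b b') ⊙ 1))
          ≡⟨ ∑-cong (list E₁) (λ a' → trans (∑-cong (list E₂) (λ b' → ⊙-∧ (eq E₁ a a') (eq E₂ b b') 1)) (∑-⊙ (list E₂) (eq E₁ a a') _)) ⟩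
        ∑ (list E₁) (λ a' → eq E₁ a a' ⊙ ∑ (list E₂) (λ b' → eq E₂ b b' ⊙ 1))
          ≡⟨ ∑-cong (list E₁) (λ a' → cong (eq E₁ a a' ⊙_) (uniq E₂ b)) ⟩
        ∑ (list E₁) (λ a' → eq E₁ a a' ⊙ 1) ≡⟨ uniq E₁ a ⟩
        1 ∎
      where open ≡-Reasoning

module _ {A : Set} (E : Enum A) where
  vecEq : {m : ℕ} → Vec A m → Vec A m → Bool
  vecEq [] [] = true
  vecEq (a ∷ v) (b ∷ w) = eq E a b ∧ vecEq v w

  vecEq-sound : {m : ℕ} {v w : Vec A m} → vecEq v w ≡ true → v ≡ w
  vecEq-sound {v = []} {[]} e = refl
  vecEq-sound {v = a ∷ v} {b ∷ w} e with eq E a b in e1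
  ... | true = cong₂ _∷_ (eq-sound E e1) (vecEq-sound e)
  ... | false = ⊥-elim (t≢f (sym e))

  vecEq-refl : {m : ℕ} (v : Vec A m) → vecEq v v ≡ true
  vecEq-refl [] = refl
  vecEq-refl (a ∷ v) rewrite eq-refl E a = vecEq-refl v

  ∑-vecs : (m : ℕ) (f : Vec A (suc m) → ℕ) →
           ∑ (allVecs (list E) (suc m)) f ≡ ∑ (list E) (λ a → ∑ (allVecs (list E) m) (λ v → f (a ∷ v)))
  ∑-vecs m f = trans (∑-concatMap (list E) _ f) (∑-cong (list E) (λ a → ∑-map (allVecs (list E) m) (a ∷_) f))

  vec-uniq : {m : ℕ} (v : Vec A m) → ∑ (allVecs (list E) m) (λ w → vecEq v w ⊙ 1) ≡ 1
  vec-uniq [] = refl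
  vec-uniq {suc m} (a ∷ v) = begin
      _ ≡⟨ ∑-vecs m _ ⟩
      ∑ (list E) (λ b → ∑ (allVecs (list E) m) (λ w → (eq E a b ∧ vecEq v w) ⊙ 1))
        ≡⟨ ∑-cong (list E) (λ b → trans (∑-cong (allVecs (list E) m) (λ w → ⊙-∧ (eq E a b) (vecEq v w) 1)) (∑-⊙ (allVecs (list E) m) (eq E a b) _)) ⟩
      ∑ (list E) (λ b → eq E a b ⊙ ∑ (allVecs (list E) m) (λ w → vecEq v w ⊙ 1))
        ≡⟨ ∑-cong (list E) (λ b → cong (eq E a b ⊙_) (vec-uniq v)) ⟩
      ∑ (list E) (λ b → eq E a b ⊙ 1) ≡⟨ uniq E a ⟩
      1 ∎
    where open ≡-Reasoning

  EVec : (m : ℕ) → Enum (Vec A m)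
  EVec m = record { eq = vecEq ; eq-sound = vecEq-sound ; eq-refl = vecEq-refl ; list = allVecs (list E) m ; uniq = vec-uniq }

vtxEq-sound : {k : ℕ} {u v : Vtx k} → vtxEq u v ≡ true → u ≡ v
vtxEq-sound {u = u} {v} = dec-sound (SumP.≡-dec Data.Fin._≟_ Data.Fin._≟_ u v)

vtxEq-refl : {k : ℕ} (u : Vtx k) → vtxEq u u ≡ true
vtxEq-refl u = dec-complete (SumP.≡-dec Data.Fin._≟_ Data.Fin._≟_ u u) refl

∑-vtx : (k : ℕ) (f : Vtx k → ℕ) → ∑ (allVtx k) f ≡ ∑ (allFin k) (λ u → f (inj₁ u)) + ∑ (allFin k) (λ w → f (inj₂ w))
∑-vtx k f = trans (∑-++ (map inj₁ (allFin k)) _ f) (cong₂ _+_ (∑-map (allFin k) inj₁ f) (∑-map (allFin k) inj₂ f))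

vtxEq-11 : {k : ℕ} (a b : Fin k) → vtxEq {k} (inj₁ a) (inj₁ b) ≡ finEq a b
vtxEq-11 a b with a Data.Fin.≟ b
... | yes _ = refl
... | no _ = refl

vtxEq-22 : {k : ℕ} (a b : Fin k) → vtxEq {k} (inj₂ a) (inj₂ b) ≡ finEq a b
vtxEq-22 a b with a Data.Fin.≟ b
... | yes _ = refl
... | no _ = refl

EVtx : (k : ℕ) → Enum (Vtx k)
EVtx k = record { eq = vtxEq ; eq-sound = vtxEq-sound ; eq-refl = vtxEq-refl ; list = allVtx k ; uniq = once }
  where
  once : ∀ v → ∑ (allVtx k) (λ t → vtxEq v t ⊙ 1) ≡ 1
  once (inj₁ a) = trans (∑-vtx k _) (trans (cong₂ _+_ (trans (∑-cong (allFin k) (λ b → cong (_⊙ 1) (vtxEq-11 a b))) (EFin-uniq k a)) (∑-0 (allFin k) (λ _ → refl))) refl)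
  once (inj₂ a) = trans (∑-vtx k _) (cong₂ _+_ (∑-0 (allFin k) (λ _ → refl)) (trans (∑-cong (allFin k) (λ b → cong (_⊙ 1) (vtxEq-22 a b))) (EFin-uniq k a)))

-- A fixed-point-free involution ι of the subset {P} of an enumerated type
-- pairs up its elements, so {P} has even size.  The pairs are split by
-- comparing list positions of a and ι a.
module _ {A : Set} (E : Enum A) where
  private
    posIn : A → List A → ℕ
    posIn a [] = 0
    posIn a (b ∷ l) = if eq E a b then 0 else suc (posIn a l)

    posIn-injective : (l : List A) (a b : A) → 1 ≤ ∑ l (λ c → eq E a c ⊙ 1) → posIn a l ≡ posIn b l → a ≡ b
    posIn-injective [] a b () e
    posIn-injective (c ∷ l) a b h e with eq E a c in ea | eq E b c in eb
    ... | true | true = trans (eq-sound E ea) (sym (eq-sound E eb))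
    ... | true | false = ⊥-elim (0≢1+n e)
    ... | false | true = ⊥-elim (0≢1+n (sym e))
    ... | false | false = posIn-injective l a b h (suc-injective e)

    pos : A → ℕ
    pos a = posIn a (list E)

    pos-injective : (a b : A) → pos a ≡ pos b → a ≡ b
    pos-injective a b = posIn-injective (list E) a b (≤-reflexive (sym (uniq E a)))

  involution-count-even : (P : A → Bool) (ι : A → A) →
     (∀ a → P a ≡ true → P (ι a) ≡ true) →
     (∀ a → P a ≡ true → ι (ι a) ≡ a) →
     (∀ a → P a ≡ true → ι a ≢ a) →
     Σ ℕ (λ n → ∑ (list E) (λ a → P a ⊙ 1) ≡ n + n)
  involution-count-even P ι Pι ιι ιne = n , trans (∑-cong (list E) split) (trans (∑-+ (list E) _ _) (cong (n +_) half))
    where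
    Before : A → Bool
    Before a = P a ∧ ⌊ pos a <? pos (ι a) ⌋
    After : A → Bool
    After a = P a ∧ ⌊ pos (ι a) <? pos a ⌋
    n : ℕ
    n = ∑ (list E) (λ a → Before a ⊙ 1)
    split : ∀ a → P a ⊙ 1 ≡ Before a ⊙ 1 + After a ⊙ 1
    split a with P a in ep
    ... | false = refl
    ... | true with <-cmp (pos a) (pos (ι a))
    ... | tri< lt _ ¬gt rewrite dec-complete (pos a <? pos (ι a)) lt | dec-false (pos (ι a) <? pos a) ¬gt = refl
    ... | tri≈ _ e _ = ⊥-elim (ιne a ep (sym (pos-injective a (ι a) e)))
    ... | tri> ¬lt _ gt rewrite dec-false (pos a <? pos (ι a)) ¬lt | dec-complete (pos (ι a) <? pos a) gt = refl
    -- ι maps the "after" elements bijectively onto the "before" elements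
    half : ∑ (list E) (λ a → After a ⊙ 1) ≡ n
    half = ∑-bijection E E After Before (λ _ → 1) (λ _ → 1) ι ι after→before before→after
             (λ a e → ιι a (∧-true₁ e)) (λ a e → ιι a (∧-true₁ e)) (λ _ _ → refl)
      where
      after→before : ∀ a → After a ≡ true → Before (ι a) ≡ true
      after→before a e rewrite Pι a (∧-true₁ e) | ιι a (∧-true₁ e) = ∧-true₂ {a = P a} e
      before→after : ∀ a → Before a ≡ true → After (ι a) ≡ true
      before→after a e rewrite Pι a (∧-true₁ e) | ιι a (∧-true₁ e) = ∧-true₂ {a = P a} e

module _ {A : Set} where
  all-true : {l : List A} {p : A → Bool} → allᵇ l p ≡ true → {a : A} → a ∈ l → p a ≡ true
  all-true {a' ∷ l} {p} h (here refl) with p a'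
  ... | true = refl
  ... | false = h
  all-true {a' ∷ l} {p} h (there m) with p a'
  ... | true = all-true h m
  ... | false = ⊥-elim (t≢f (sym h))

  all-intro : (l : List A) {p : A → Bool} → (∀ {a} → a ∈ l → p a ≡ true) → allᵇ l p ≡ true
  all-intro [] h = refl
  all-intro (a ∷ l) h rewrite h (here refl) = all-intro l (λ m → h (there m))

  all-false : {l : List A} {p : A → Bool} {a : A} → a ∈ l → p a ≡ false → allᵇ l p ≡ false
  all-false {a' ∷ l} {p} (here refl) e rewrite e = refl
  all-false {a' ∷ l} {p} (there m) e with p a'
  ... | true = all-false m e
  ... | false = refl

  all-false-elim : (l : List A) {p : A → Bool} → allᵇ l p ≡ false → ∃[ a ] (a ∈ l × p a ≡ false)
  all-false-elim [] ()
  all-false-elim (a ∷ l) {p} h with p a in e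
  ... | true = let (b , m , same-iterate) = all-false-elim l h in b , there m , same-iterate
  ... | false = a , here refl , e

  any-intro : {l : List A} {p : A → Bool} {a : A} → a ∈ l → p a ≡ true → anyᵇ l p ≡ true
  any-intro {a' ∷ l} {p} (here refl) e rewrite e = refl
  any-intro {a' ∷ l} {p} (there m) e with p a'
  ... | true = refl
  ... | false = any-intro m e

  any-elim : (l : List A) {p : A → Bool} → anyᵇ l p ≡ true → ∃[ a ] (a ∈ l × p a ≡ true)
  any-elim [] ()
  any-elim (a ∷ l) {p} h with p a in e
  ... | true = a , here refl , e
  ... | false = let (b , m , same-iterate) = any-elim l h in b , there m , same-iterate

  all-cong : (l : List A) {p q : A → Bool} → (∀ a → p a ≡ q a) → allᵇ l p ≡ allᵇ l q
  all-cong [] e = refl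
  all-cong (a ∷ l) e = cong₂ _∧_ (e a) (all-cong l e)

  any-cong : (l : List A) {p q : A → Bool} → (∀ a → p a ≡ q a) → anyᵇ l p ≡ anyᵇ l q
  any-cong [] e = refl
  any-cong (a ∷ l) e = cong₂ _∨_ (e a) (any-cong l e)

  countᵇ-cong : (l : List A) {p q : A → Bool} → (∀ a → p a ≡ q a) → countᵇ l p ≡ countᵇ l q
  countᵇ-cong l e = trans (count-∑ l _) (trans (∑-cong l (λ a → cong (_⊙ 1) (e a))) (sym (count-∑ l _)))

  filter-true : (p : A → Bool) (l : List A) {a : A} → a ∈ filterᵇ p l → p a ≡ true
  filter-true p (b ∷ l) m with p b in e
  filter-true p (b ∷ l) (here refl) | true = e
  filter-true p (b ∷ l) (there m) | true = filter-true p l m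
  filter-true p (b ∷ l) m | false = filter-true p l m

find : {A : Set} → (A → Bool) → List A → A → A
find p [] d = d
find p (a ∷ l) d = if p a then a else find p l d

find-true : {A : Set} (p : A → Bool) (l : List A) (d : A) {a : A} → a ∈ l → p a ≡ true → p (find p l d) ≡ true
find-true p (b ∷ l) d (here refl) e with p b in eb
... | true = eb
... | false = ⊥-elim (t≢f (sym e))
find-true p (b ∷ l) d (there m) e with p b in eb
... | true = eb
... | false = find-true p l d m e

find-cong : {A : Set} (p q : A → Bool) (l : List A) (d : A) → (∀ a → p a ≡ q a) → find p l d ≡ find q l d
find-cong p q [] d e = refl
find-cong p q (a ∷ l) d e rewrite e a with q a
... | true = refl
... | false = find-cong p q l d e

Inj : {k : ℕ} → (Fin k → Fin k) → Set
Inj f = ∀ {a b} → f a ≡ f b → a ≡ b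

Surj : {k : ℕ} → (Fin k → Fin k) → Set
Surj f = ∀ u → ∃[ w ] f w ≡ u

inv : {k : ℕ} → (Fin k → Fin k) → Fin k → Fin k
inv {k} f u = find (λ w → finEq (f w) u) (allFin k) u

module _ {k : ℕ} where
  inv-r : (f : Fin k → Fin k) → Surj f → ∀ u → f (inv f u) ≡ u
  inv-r f sj u = finEq-sound (find-true (λ w → finEq (f w) u) (allFin k) u (∈-allFin (proj₁ (sj u)))
                   (subst (λ z → finEq z u ≡ true) (sym (proj₂ (sj u))) (finEq-refl u)))

  inv-cong : (f g : Fin k → Fin k) → (∀ w → f w ≡ g w) → ∀ u → inv f u ≡ inv g u
  inv-cong f g e u = find-cong _ _ (allFin k) u (λ w → cong (λ z → finEq z u) (e w))

inj→surj : {k : ℕ} (f : Fin k → Fin k) → Inj f → Surj f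
inj→surj {suc n} f inj u with FP.any? (λ w → f w Data.Fin.≟ u)
... | yes ex = ex
... | no ¬ex =
  let (i , j , i<j , collision) = FP.pigeonhole (n<1+n n) skip
  in ⊥-elim (FP.<⇒≢ i<j (inj (FP.punchOut-injective (λ e → ¬ex (i , sym e)) (λ e → ¬ex (j , sym e)) collision)))
  where
  -- f misses u, so it factors through Fin n by skipping u
  skip : Fin (suc n) → Fin n
  skip w = punchOut {i = u} {j = f w} (λ e → ¬ex (w , sym e))

module _ {k : ℕ} where
  inv-l : (f : Fin k → Fin k) → Inj f → ∀ w → inv f (f w) ≡ w
  inv-l f inj w = inj (inv-r f (inj→surj f inj) (f w))

  inv-inj : (f : Fin k → Fin k) → Surj f → Inj (inv f)
  inv-inj f sj {a} {b} e = trans (sym (inv-r f sj a)) (trans (cong f e) (inv-r f sj b))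

  surj→inj : (f : Fin k → Fin k) → Surj f → Inj f
  surj→inj f sj {a} {b} e = trans (sym (proj₂ (hs a))) (trans (cong h (trans (sym ra) (trans e rb))) (proj₂ (hs b)))
    where
    h : Fin k → Fin k
    h = inv f
    hs : Surj h
    hs = inj→surj h (inv-inj f sj)
    ra : f a ≡ proj₁ (hs a)
    ra = trans (cong f (sym (proj₂ (hs a)))) (inv-r f sj _)
    rb : f b ≡ proj₁ (hs b)
    rb = trans (cong f (sym (proj₂ (hs b)))) (inv-r f sj _)

  inv-inv : (f : Fin k → Fin k) → Inj f → ∀ w → inv (inv f) w ≡ f w
  inv-inv f inj w = trans (cong (inv (inv f)) (sym (inv-l f inj w))) (inv-l (inv f) (inv-inj f (inj→surj f inj)) (f w))

inOrbit : {k : ℕ} → (Fin k → Fin k) → Fin k → Fin k → Bool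
inOrbit {k} f a b = anyᵇ (upTo k) (λ j → finEq (iter f j a) b)

-- Orbits of a permutation ν of Fin k: every point is periodic with period
-- at most k, so inOrbit ν a b holds iff b is some iterate of a.
module Orbits {k : ℕ} (ν : Fin k → Fin k) (νinj : Inj ν) where
  it : ℕ → Fin k → Fin k
  it j a = iter ν j a

  it-add : ∀ i j a → it (i + j) a ≡ it i (it j a)
  it-add zero j a = refl
  it-add (suc i) j a = cong ν (it-add i j a)

  it-comm : ∀ i j a → it i (it j a) ≡ it j (it i a)
  it-comm i j a = trans (sym (it-add i j a)) (trans (cong (λ z → it z a) (+-comm i j)) (it-add j i a))

  it-inj : ∀ i {a b} → it i a ≡ it i b → a ≡ b
  it-inj zero e = e
  it-inj (suc i) e = it-inj i (νinj e)

  -- by pigeonhole two of the iterates 0 .. k of a coincide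
  period : ∀ a → ∃[ p ] (0 < p × p ≤ k × it p a ≡ a)
  period a with FP.pigeonhole (n<1+n k) (λ (i : Fin (suc k)) → it (toℕ i) a)
  ... | i , j , i<j , eij = p , m<n⇒0<n∸m i<j , p≤k , per
    where
    p : ℕ
    p = toℕ j ∸ toℕ i
    p≤k : p ≤ k
    p≤k = ≤-trans (m∸n≤m (toℕ j) (toℕ i)) (≤-pred (FP.toℕ<n j))
    per : it p a ≡ a
    per = it-inj (toℕ i) (sym (begin
        it (toℕ i) a ≡⟨ eij ⟩
        it (toℕ j) a ≡⟨ cong (λ z → it z a) (sym (m∸n+n≡m (<⇒≤ i<j))) ⟩
        it (p + toℕ i) a ≡⟨ it-add p (toℕ i) a ⟩
        it p (it (toℕ i) a) ≡⟨ it-comm p (toℕ i) a ⟩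
        it (toℕ i) (it p a) ∎))
      where open ≡-Reasoning

  it-mult : ∀ p a → it p a ≡ a → ∀ t → it (t * p) a ≡ a
  it-mult p a e zero = refl
  it-mult p a e (suc t) = trans (it-add p (t * p) a) (trans (cong (it p) (it-mult p a e t)) e)

  it-mod : ∀ p' a → it (suc p') a ≡ a → ∀ j → it j a ≡ it (j % suc p') a
  it-mod p' a e j = begin
      it j a ≡⟨ cong (λ z → it z a) (m≡m%n+[m/n]*n j (suc p')) ⟩
      it (j % suc p' + (j / suc p') * suc p') a ≡⟨ it-add (j % suc p') ((j / suc p') * suc p') a ⟩
      it (j % suc p') (it ((j / suc p') * suc p') a) ≡⟨ cong (it (j % suc p')) (it-mult (suc p') a e (j / suc p')) ⟩
      it (j % suc p') a ∎
    where open ≡-Reasoning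

  orb-intro : ∀ j a b → it j a ≡ b → inOrbit ν a b ≡ true
  orb-intro j a b e with period a
  ... | suc p' , _ , p≤k , per = any-intro (∈-upTo⁺ (<-≤-trans (m%n<n j (suc p')) p≤k))
          (subst (λ z → finEq z b ≡ true) (trans (sym e) (it-mod p' a per j)) (finEq-refl b))

  orb-elim : ∀ a b → inOrbit ν a b ≡ true → ∃[ j ] it j a ≡ b
  orb-elim a b e with any-elim (upTo k) e
  ... | j , _ , same-iterate = j , finEq-sound same-iterate

  -- orbits are symmetric: going around the cycle leads back
  orb-sym : ∀ j a b → it j a ≡ b → ∃[ i ] it i b ≡ a
  orb-sym j a b e with period a
  ... | suc p' , _ , _ , per = p' * j , (begin
        it (p' * j) b ≡⟨ cong (it (p' * j)) (sym e) ⟩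
        it (p' * j) (it j a) ≡⟨ sym (it-add (p' * j) j a) ⟩
        it (p' * j + j) a ≡⟨ cong (λ z → it z a) (trans (+-comm (p' * j) j) (*-comm (suc p') j)) ⟩
        it (j * suc p') a ≡⟨ it-mult (suc p') a per j ⟩
        a ∎)
    where open ≡-Reasoning

  orb-trans : ∀ i j a b c → it i a ≡ b → it j b ≡ c → it (j + i) a ≡ c
  orb-trans i j a b c e1 e2 = trans (it-add j i a) (trans (cong (it j) e1) e2)

module PolyCount (X : Set) (allX : List X) (_≟X_ : X → X → Bool) where
  open Poly X allX _≟X_

  cnt : Monomial X → Pol → ℕ
  cnt m p = countᵇ p (monoEq m)

  cnt-∑ : (m : Monomial X) (p : Pol) → cnt m p ≡ ∑ p (λ μ → monoEq m μ ⊙ 1)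
  cnt-∑ m p = count-∑ p (monoEq m)

  cnt-Σₚ : {A : Set} (m : Monomial X) (l : List A) (f : A → Pol) → cnt m (Σₚ l f) ≡ ∑ l (λ a → cnt m (f a))
  cnt-Σₚ m [] f = refl
  cnt-Σₚ m (a ∷ l) f = trans (cnt-∑ m (f a ++ Σₚ l f)) (trans (∑-++ (f a) (Σₚ l f) _)
       (cong₂ _+_ (sym (cnt-∑ m (f a))) (trans (sym (cnt-∑ m (Σₚ l f))) (cnt-Σₚ m l f))))

  cnt-single : (m μ : Monomial X) → cnt m (μ ∷ []) ≡ monoEq m μ ⊙ 1
  cnt-single m μ with monoEq m μ
  ... | true = refl
  ... | false = refl

  monoEq-cong : (m : Monomial X) {μ μ' : Monomial X} → (∀ y → μ y ≡ μ' y) → monoEq m μ ≡ monoEq m μ'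
  monoEq-cong m e = all-cong allX (λ y → cong (λ z → ⌊ m y Data.Nat.≟ z ⌋) (e y))

  monoEq-refl : (m : Monomial X) → monoEq m m ≡ true
  monoEq-refl m = all-intro allX (λ {y} _ → dec-complete (m y Data.Nat.≟ m y) refl)

  monoEq-sound : (∀ y → y ∈ allX) → (m μ : Monomial X) → monoEq m μ ≡ true → ∀ y → m y ≡ μ y
  monoEq-sound allX-complete m μ e y = dec-sound (m y Data.Nat.≟ μ y) (all-true e (allX-complete y))

  prodMono : {A : Set} → List A → (A → Monomial X) → Monomial X
  prodMono l μ = foldr (λ a acc z → μ a z + acc z) (λ _ → 0) l

  prodMono-∑ : {A : Set} (l : List A) (μ : A → Monomial X) (y : X) → prodMono l μ y ≡ ∑ l (λ a → μ a y)
  prodMono-∑ [] μ y = refl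
  prodMono-∑ (a ∷ l) μ y = cong (μ a y +_) (prodMono-∑ l μ y)

  *ₚ-0 : (p : Pol) → p *ₚ [] ≡ []
  *ₚ-0 [] = refl
  *ₚ-0 (m ∷ p) = *ₚ-0 p

  Πₚ-single : {A : Set} (l : List A) (F : A → Pol) (μ : A → Monomial X) →
             (∀ a → F a ≡ μ a ∷ []) → Πₚ l F ≡ prodMono l μ ∷ []
  Πₚ-single [] F μ h = refl
  Πₚ-single (a ∷ l) F μ h rewrite h a | Πₚ-single l F μ h = refl

  Πₚ-single-filter : {A : Set} (l : List A) (Q : A → Bool) (F : A → Pol) (μ : A → Monomial X) →
             (∀ a → Q a ≡ true → F a ≡ μ a ∷ []) → Πₚ (filterᵇ Q l) F ≡ prodMono (filterᵇ Q l) μ ∷ []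
  Πₚ-single-filter [] Q F μ h = refl
  Πₚ-single-filter (a ∷ l) Q F μ h with Q a in e
  ... | true rewrite h a e | Πₚ-single-filter l Q F μ h = refl
  ... | false = Πₚ-single-filter l Q F μ h

  Πₚ-zero-filter : {A : Set} (l : List A) (Q : A → Bool) (F : A → Pol) {a : A} →
                   a ∈ l → Q a ≡ true → F a ≡ [] → Πₚ (filterᵇ Q l) F ≡ []
  Πₚ-zero-filter (b ∷ l) Q F (here refl) e z with Q b
  Πₚ-zero-filter (b ∷ l) Q F (here refl) refl z | true rewrite z = refl
  Πₚ-zero-filter (b ∷ l) Q F (there m) e z with Q b
  ... | true rewrite Πₚ-zero-filter l Q F m e z = *ₚ-0 (F b)
  ... | false = Πₚ-zero-filter l Q F m e z

  Σₚ-zero : {A : Set} (l : List A) (f : A → Pol) → (∀ a → f a ≡ []) → Σₚ l f ≡ []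
  Σₚ-zero [] f h = refl
  Σₚ-zero (a ∷ l) f h rewrite h a = Σₚ-zero l f h

  Σₚ-one : {A : Set} (E : Enum A) (f : A → Pol) (a₀ : A) → (∀ a → a ≢ a₀ → f a ≡ []) → Σₚ (list E) f ≡ f a₀
  Σₚ-one {A} E f a₀ h = go (list E) (uniq E a₀)
    where
    absent : (l : List A) → ∑ l (λ a → eq E a₀ a ⊙ 1) ≡ 0 → Σₚ l f ≡ []
    absent [] c = refl
    absent (a ∷ l) c with eq E a₀ a in e
    ... | false rewrite h a (λ a≡a₀ → t≢f (trans (sym (eq-refl E a₀)) (trans (cong (eq E a₀) (sym a≡a₀)) e))) = absent l c
    go : (l : List A) → ∑ l (λ a → eq E a₀ a ⊙ 1) ≡ 1 → Σₚ l f ≡ f a₀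
    go (a ∷ l) c with eq E a₀ a in e
    ... | true = begin
        f a ++ Σₚ l f ≡⟨ cong (f a ++_) (absent l (suc-injective c)) ⟩
        f a ++ [] ≡⟨ LP.++-identityʳ (f a) ⟩
        f a ≡⟨ cong f (sym (eq-sound E e)) ⟩
        f a₀ ∎
      where open ≡-Reasoning
    ... | false rewrite h a (λ a≡a₀ → t≢f (trans (sym (eq-refl E a₀)) (trans (cong (eq E a₀) (sym a≡a₀)) e))) = go l c

two≤ : {k : ℕ} {a b : Fin k} → a ≢ b → 2 ≤ k
two≤ {suc zero} {zero} {zero} ne = ⊥-elim (ne refl)
two≤ {suc (suc k)} ne = s≤s (s≤s z≤n)

another : {k : ℕ} → 2 ≤ k → (a : Fin k) → ∃[ b ] b ≢ a
another {suc (suc k)} _ zero = suc zero , λ ()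
another {suc (suc k)} _ (suc a) = zero , λ ()
another {suc zero} (s≤s ()) zero

half-of-three : ∀ n → 3 ≤ n + n → 2 ≤ n
half-of-three (suc zero) (s≤s (s≤s ()))
half-of-three (suc (suc n)) _ = s≤s (s≤s z≤n)

parity : ∀ i → ∃[ j ] (i ≡ j + j ⊎ i ≡ suc (j + j))
parity zero = 0 , inj₁ refl
parity (suc i) with parity i
... | j , inj₁ e = j , inj₂ (cong suc e)
... | j , inj₂ e = suc j , inj₁ (trans (cong suc e) (sym (+-suc (suc j) j)))

half< : ∀ {k} j → j + j < k + k → j < k
half< {k} j h with j <? k
... | yes p = p
... | no np = ⊥-elim (<-irrefl refl (<-≤-trans h (+-mono-≤ (≮⇒≥ np) (≮⇒≥ np))))

module Setting (k : ℕ) (adj : Fin k → Fin k → Bool) (s : Fin k) where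
  open GF2 k using (Pol; _*ₚ_; Σₚ; Πₚ; monoEq)
  open PolyCount (Var k) (allVar k) varEq public

  Arc : Set
  Arc = Fin k × Fin k

  allArcs : List Arc
  allArcs = GF2.allArcs k k

  arcEq : Arc → Arc → Bool
  arcEq = GF2.arcEq k k

  isCycleCover : (Arc → Bool) → (Arc → Bool) → Bool
  isCycleCover = GF2.isCycleCover k k

  isSurjOnto : (Arc → Bool) → (Fin k → Arc) → Bool
  isSurjOnto = GF2.isSurjOnto k k {k}

  preimage : (Fin k → Arc) → Arc → Vec Bool k
  preimage = GF2.preimage k k {k}

  EF : Enum (Fin k)
  EF = EFin k

  EArc : Enum Arc
  EArc = EProd EF EF

  arcEq-sound : {a b : Arc} → arcEq a b ≡ true → a ≡ b
  arcEq-sound = eq-sound EArc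

  arcEq-refl : (a : Arc) → arcEq a a ≡ true
  arcEq-refl = eq-refl EArc

  -- A labeling assigns to each label w ∈ V₂ an arc (γ w , β w) of V₁ × V₁;
  -- the surjections g : V₂ ↠ C of Λ are labelings.
  Labeling : Set
  Labeling = Vec Arc k

  ELabeling : Enum Labeling
  ELabeling = EVec EArc k

  γ : Labeling → Fin k → Fin k
  γ g w = proj₁ (lookup g w)

  β : Labeling → Fin k → Fin k
  β g w = proj₂ (lookup g w)

  injᵇ : (Fin k → Fin k) → Bool
  injᵇ f = allᵇ (allFin k) (λ a → allᵇ (allFin k) (λ b → not (finEq (f a) (f b)) ∨ finEq a b))

  labelOK : Labeling → Fin k → Bool
  labelOK g w = inN adj (γ g w) (β g w) w ∧ not (finEq (γ g w) (β g w))

  Good : Labeling → Bool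
  Good g = allᵇ (allFin k) (labelOK g) ∧ (injᵇ (γ g) ∧ injᵇ (β g))

  record IsGood (g : Labeling) : Set where
    field
      labelsOK : ∀ w → labelOK g w ≡ true
      γinj : Inj (γ g)
      βinj : Inj (β g)

  injᵇ-sound : (f : Fin k → Fin k) → injᵇ f ≡ true → Inj f
  injᵇ-sound f h {a} {b} e = finEq-sound (∨-elim-not (all-true (all-true h (∈-allFin a)) (∈-allFin b))
                               (subst (λ z → finEq (f a) z ≡ true) e (finEq-refl (f a))))

  injᵇ-complete : (f : Fin k → Fin k) → Inj f → injᵇ f ≡ true
  injᵇ-complete f inj = all-intro (allFin k) (λ {a} _ → all-intro (allFin k) (λ {b} _ → implication a b))
    where
    implication : ∀ a b → (not (finEq (f a) (f b)) ∨ finEq a b) ≡ true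
    implication a b with finEq (f a) (f b) in e
    ... | false = refl
    ... | true rewrite inj (finEq-sound e) | finEq-refl b = refl

  good-sound : (g : Labeling) → Good g ≡ true → IsGood g
  good-sound g h = record { labelsOK = λ w → all-true (∧-true₁ h) (∈-allFin w)
                          ; γinj = injᵇ-sound (γ g) (∧-true₁ (∧-true₂ {allᵇ (allFin k) (labelOK g)} h))
                          ; βinj = injᵇ-sound (β g) (∧-true₂ (∧-true₂ {allᵇ (allFin k) (labelOK g)} h)) }

  good-complete : (g : Labeling) → IsGood g → Good g ≡ true
  good-complete g gp = ∧-intro (all-intro (allFin k) (λ {w} _ → IsGood.labelsOK gp w))
                          (∧-intro (injᵇ-complete _ (IsGood.γinj gp)) (injᵇ-complete _ (IsGood.βinj gp)))

  -- The monomial of a labeling: ∏_w x_{γ w, w} x_{w, β w}, where the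
  -- variable x_{w v} is the unsymmetrised (true , v , w) when v = s.
  indicator : Var k → Monomial (Var k)
  indicator z y = if varEq z y then 1 else 0

  xIn : Fin k → Fin k → Var k
  xIn u w = false , u , w

  xOut : Fin k → Fin k → Var k
  xOut w v = if finEq v s then (true , v , w) else (false , v , w)

  xOut-eq : ∀ w v → x s (inj₂ w) (inj₁ v) ≡ indicator (xOut w v) ∷ []
  xOut-eq w v with finEq v s
  ... | true = refl
  ... | false = refl

  labelTerm : Arc → Fin k → Monomial (Var k)
  labelTerm a w y = indicator (xIn (proj₁ a) w) y + indicator (xOut w (proj₂ a)) y

  labelingMonomial : Labeling → Monomial (Var k)
  labelingMonomial g y = ∑ (allFin k) (λ w → labelTerm (lookup g w) w y)

  arcSetOf : Vec Bool (k * k) → Arc → Bool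
  arcSetOf χ a = lookup χ (combine (proj₁ a) (proj₂ a))

  image : Labeling → Arc → Bool
  image g a = anyᵇ (allFin k) (λ l → arcEq (lookup g l) a)

  imageCode : Labeling → Vec Bool (k * k)
  imageCode g = tabulate (λ i → image g (remQuot {k} k i))

  arcSetOf-imageCode : ∀ g a → arcSetOf (imageCode g) a ≡ image g a
  arcSetOf-imageCode g a = trans (VP.lookup∘tabulate (λ i → image g (remQuot {k} k i)) (combine (proj₁ a) (proj₂ a)))
                                 (cong (image g) (FP.remQuot-combine (proj₁ a) (proj₂ a)))

  imageCode-unique : ∀ χ g → (∀ a → arcSetOf χ a ≡ image g a) → χ ≡ imageCode g
  imageCode-unique χ g e = trans (sym (VP.tabulate∘lookup χ))
    (VP.tabulate-cong λ i → trans (cong (lookup χ) (sym (FP.combine-remQuot {k} k i))) (e (remQuot {k} k i)))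

  image-elim : ∀ g a → image g a ≡ true → ∃[ w ] lookup g w ≡ a
  image-elim g a e with any-elim (allFin k) e
  ... | w , _ , same-iterate = w , arcEq-sound same-iterate

  image-intro : ∀ g w → image g (lookup g w) ≡ true
  image-intro g w = any-intro {p = λ l → arcEq (lookup g l) (lookup g w)} (∈-allFin w) (arcEq-refl (lookup g w))

  surj-image : (C : Arc → Bool) (g : Labeling) → isSurjOnto C (lookup g) ≡ true → ∀ a → C a ≡ image g a
  surj-image C g h a = bool-iff (λ ca → ∨-elim-not (all-true (∧-true₂ {allᵇ (allFin k) (λ l → C (lookup g l))} h) (mem EArc a)) ca)
                                (λ ia → let (w , e) = image-elim g a ia in subst (λ z → C z ≡ true) e (all-true (∧-true₁ h) (∈-allFin w)))

  surj-label : (C : Arc → Bool) (g : Labeling) → isSurjOnto C (lookup g) ≡ true → ∀ w → C (lookup g w) ≡ true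
  surj-label C g h w = all-true (∧-true₁ h) (∈-allFin w)

  image-surj : (C : Arc → Bool) (g : Labeling) → (∀ a → C a ≡ image g a) → isSurjOnto C (lookup g) ≡ true
  image-surj C g e = ∧-intro (all-intro (allFin k) (λ {w} _ → trans (e _) (image-intro g w)))
                             (all-intro allArcs (λ {a} _ → covered a))
    where
    covered : ∀ a → (not (C a) ∨ image g a) ≡ true
    covered a rewrite e a with image g a
    ... | true = refl
    ... | false = refl

  isCycleCover-cong : (A C C' : Arc → Bool) → (∀ a → C a ≡ C' a) → isCycleCover A C ≡ isCycleCover A C'
  isCycleCover-cong A C C' e = cong₂ _∧_ (all-cong allArcs (λ a → cong (λ z → not z ∨ A a) (e a)))
      (cong₂ _∧_ (all-cong (allFin k) (λ u → cong (λ z → ⌊ z Data.Nat.≟ 1 ⌋) (countᵇ-cong (allFin k) (λ v → e (u , v)))))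
                 (all-cong (allFin k) (λ v → cong (λ z → ⌊ z Data.Nat.≟ 1 ⌋) (countᵇ-cong (allFin k) (λ u → e (u , v))))))

  module Cover {A C : Arc → Bool} (cc : isCycleCover A C ≡ true) where
    arcs : ∀ a → C a ≡ true → A a ≡ true
    arcs a = ∨-elim-not (all-true (∧-true₁ cc) (mem EArc a))

    outdeg : ∀ u → countᵇ (allFin k) (λ v → C (u , v)) ≡ 1
    outdeg u = dec-sound (countᵇ (allFin k) (λ v → C (u , v)) Data.Nat.≟ 1)
                 (all-true (∧-true₁ (∧-true₂ {allᵇ allArcs (λ a → not (C a) ∨ A a)} cc)) (∈-allFin u))

    indeg : ∀ v → countᵇ (allFin k) (λ u → C (u , v)) ≡ 1
    indeg v = dec-sound (countᵇ (allFin k) (λ u → C (u , v)) Data.Nat.≟ 1)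
                (all-true (∧-true₂ {allᵇ (allFin k) (λ u → ⌊ countᵇ (allFin k) (λ v → C (u , v)) Data.Nat.≟ 1 ⌋)}
                            (∧-true₂ {allᵇ allArcs (λ a → not (C a) ∨ A a)} cc)) (∈-allFin v))

  count-two : (p : Fin k → Bool) (v₁ v₂ : Fin k) → v₁ ≢ v₂ → p v₁ ≡ true → p v₂ ≡ true → 2 ≤ countᵇ (allFin k) p
  count-two p v₁ v₂ ne e₁ e₂ = begin
      2 ≡⟨ sym (trans (∑-+ (allFin k) _ _) (cong₂ _+_ (delta EF v₁ (λ _ → 1)) (delta EF v₂ (λ _ → 1)))) ⟩
      ∑ (allFin k) (λ v → finEq v₁ v ⊙ 1 + finEq v₂ v ⊙ 1) ≤⟨ ∑-mono (allFin k) pointwise ⟩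
      ∑ (allFin k) (λ v → p v ⊙ 1) ≡⟨ sym (count-∑ (allFin k) p) ⟩
      countᵇ (allFin k) p ∎
    where
    open ≤-Reasoning
    pointwise : ∀ v → finEq v₁ v ⊙ 1 + finEq v₂ v ⊙ 1 ≤ p v ⊙ 1
    pointwise v with finEq v₁ v in a | finEq v₂ v in b
    ... | true | true = ⊥-elim (ne (trans (finEq-sound a) (sym (finEq-sound b))))
    ... | true | false rewrite sym (finEq-sound a) | e₁ = ≤-refl
    ... | false | true rewrite sym (finEq-sound b) | e₂ = ≤-refl
    ... | false | false = z≤n

  preimage-lookup : ∀ g a w → lookup (preimage (lookup g) a) w ≡ arcEq (lookup g w) a
  preimage-lookup g a w = VP.lookup∘tabulate _ w

  singleton-true : {S : Vec Bool k} {w : Fin k} → (∀ w' → lookup S w' ≡ finEq w' w) → isSingleton S w ≡ true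
  singleton-true {S} {w} h = all-intro (allFin k) (λ {w'} _ → dec-complete (lookup S w' Data.Bool.≟ finEq w' w) (h w'))

  singleton-false : {S : Vec Bool k} {w w' : Fin k} → lookup S w' ≡ true → finEq w' w ≡ false → isSingleton S w ≡ false
  singleton-false {S} {w} {w'} e₁ e₂ = all-false (∈-allFin w')
    (dec-false (lookup S w' Data.Bool.≟ finEq w' w) λ e → t≢f (trans (sym e₁) (trans e e₂)))

  pathTerm : Arc → Fin k → Pol
  pathTerm a w = x s (inj₁ (proj₁ a)) (inj₂ w) *ₚ x s (inj₂ w) (inj₁ (proj₂ a))

  pathTerm-eq : ∀ a w → pathTerm a w ≡ labelTerm a w ∷ []
  pathTerm-eq a w rewrite xOut-eq w (proj₂ a) = refl

  condition : Arc → Vec Bool k → Fin k → Bool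
  condition a S w = arcF adj a ∧ inN adj (proj₁ a) (proj₂ a) w ∧ isSingleton S w

  condition-nonsingleton : ∀ a S w → isSingleton S w ≡ false → condition a S w ≡ false
  condition-nonsingleton a S w e rewrite e = trans (cong (arcF adj a ∧_) (BP.∧-zeroʳ _)) (BP.∧-zeroʳ _)

  fLab-zero : ∀ a S → (∀ w → condition a S w ≡ false) → fLab adj s a S ≡ []
  fLab-zero a S h = Σₚ-zero (allFin k) _ (λ w → cong (λ b → if b then pathTerm a w else []) (h w))

  coverFactor : Labeling → Arc → Pol
  coverFactor g a = fLab adj s a (preimage (lookup g) a)

  coverTerm : (Arc → Bool) → Labeling → Pol
  coverTerm C g = Πₚ (filterᵇ C allArcs) (coverFactor g)

  module GoodLabeling (g : Labeling) (gp : IsGood g) where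
    open IsGood gp

    label-injective : ∀ {w₁ w₂} → lookup g w₁ ≡ lookup g w₂ → w₁ ≡ w₂
    label-injective e = γinj (cong proj₁ e)

    image-out : ∀ u v → image g (u , v) ≡ finEq (β g (inv (γ g) u)) v
    image-out u v = bool-iff forward backward
      where
      forward : image g (u , v) ≡ true → finEq (β g (inv (γ g) u)) v ≡ true
      forward h with image-elim g _ h
      ... | w , e = subst (λ z → finEq z v ≡ true)
                      (sym (trans (cong (λ z → β g (inv (γ g) z)) (sym (cong proj₁ e))) (cong (β g) (inv-l (γ g) γinj w))))
                      (subst (λ z → finEq z v ≡ true) (sym (cong proj₂ e)) (finEq-refl v))
      backward : finEq (β g (inv (γ g) u)) v ≡ true → image g (u , v) ≡ true
      backward h = subst (λ z → image g z ≡ true) (cong₂ _,_ (inv-r (γ g) (inj→surj (γ g) γinj) u) (finEq-sound h))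
                     (image-intro g (inv (γ g) u))

    image-in : ∀ u v → image g (u , v) ≡ finEq (γ g (inv (β g) v)) u
    image-in u v = bool-iff forward backward
      where
      forward : image g (u , v) ≡ true → finEq (γ g (inv (β g) v)) u ≡ true
      forward h with image-elim g _ h
      ... | w , e = subst (λ z → finEq z u ≡ true)
                      (sym (trans (cong (λ z → γ g (inv (β g) z)) (sym (cong proj₂ e))) (cong (γ g) (inv-l (β g) βinj w))))
                      (subst (λ z → finEq z u ≡ true) (sym (cong proj₁ e)) (finEq-refl u))
      backward : finEq (γ g (inv (β g) v)) u ≡ true → image g (u , v) ≡ true
      backward h = subst (λ z → image g z ≡ true) (cong₂ _,_ (finEq-sound h) (inv-r (β g) (inj→surj (β g) βinj) v))
                     (image-intro g (inv (β g) v))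

    label-arc : ∀ w → arcF adj (lookup g w) ≡ true
    label-arc w = ∧-intro {a = not (finEq (γ g w) (β g w))} (∧-true₂ {a = inN adj (γ g w) (β g w) w} (labelsOK w))
                    (any-intro {p = inN adj (γ g w) (β g w)} (∈-allFin w) (∧-true₁ (labelsOK w)))

    image-cover : isCycleCover (arcF adj) (image g) ≡ true
    image-cover = ∧-intro (all-intro allArcs (λ {a} _ → arc-ok a))
                     (∧-intro (all-intro (allFin k) (λ {u} _ → cong (λ z → ⌊ z Data.Nat.≟ 1 ⌋) (out-one u)))
                              (all-intro (allFin k) (λ {v} _ → cong (λ z → ⌊ z Data.Nat.≟ 1 ⌋) (in-one v))))
      where
      arc-ok : ∀ a → (not (image g a) ∨ arcF adj a) ≡ true
      arc-ok a with image g a in e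
      ... | false = refl
      ... | true with image-elim g a e
      ... | w , refl rewrite label-arc w = refl
      out-one : ∀ u → countᵇ (allFin k) (λ v → image g (u , v)) ≡ 1
      out-one u = trans (count-∑ (allFin k) _) (trans (∑-cong (allFin k) (λ v → cong (_⊙ 1) (image-out u v))) (EFin-uniq k _))
      in-one : ∀ v → countᵇ (allFin k) (λ u → image g (u , v)) ≡ 1
      in-one v = trans (count-∑ (allFin k) _) (trans (∑-cong (allFin k) (λ u → cong (_⊙ 1) (image-in u v))) (EFin-uniq k _))

    labelOf : Arc → Fin k
    labelOf a = find (λ l → arcEq (lookup g l) a) (allFin k) s

    labelOf-lookup : ∀ w → labelOf (lookup g w) ≡ w
    labelOf-lookup w = label-injective (arcEq-sound (find-true (λ l → arcEq (lookup g l) (lookup g w)) (allFin k) s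
                         (∈-allFin w) (arcEq-refl (lookup g w))))

    lookup-labelOf : ∀ a → image g a ≡ true → lookup g (labelOf a) ≡ a
    lookup-labelOf a h with image-elim g a h
    ... | w , refl = cong (lookup g) (labelOf-lookup w)

    preimage-singleton : ∀ w₀ w' → lookup (preimage (lookup g) (lookup g w₀)) w' ≡ finEq w' w₀
    preimage-singleton w₀ w' = trans (preimage-lookup g _ w')
      (bool-iff (λ e → subst (λ z → finEq z w₀ ≡ true) (sym (label-injective (arcEq-sound e))) (finEq-refl w₀))
                (λ e → subst (λ z → arcEq (lookup g z) (lookup g w₀) ≡ true) (sym (finEq-sound e)) (arcEq-refl (lookup g w₀))))

    -- on the arc of label w₀ only the summand w = w₀ of fLab survives
    fLab-label : ∀ w₀ → fLab adj s (lookup g w₀) (preimage (lookup g) (lookup g w₀)) ≡ labelTerm (lookup g w₀) w₀ ∷ []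
    fLab-label w₀ = trans (Σₚ-one EF _ w₀ others) (trans (cong (λ b → if b then pathTerm a w₀ else []) holds) (pathTerm-eq a w₀))
      where
      a : Arc
      a = lookup g w₀
      P : Vec Bool k
      P = preimage (lookup g) a
      others : ∀ w → w ≢ w₀ → (if condition a P w then pathTerm a w else []) ≡ []
      others w ne rewrite condition-nonsingleton a P w
        (singleton-false {S = P} {w' = w₀} (trans (preimage-singleton w₀ w₀) (finEq-refl w₀)) (finEq-false λ e → ne (sym e))) = refl
      inNeighbourhood : inN adj (γ g w₀) (β g w₀) w₀ ≡ true
      inNeighbourhood = ∧-true₁ (labelsOK w₀)
      singleton : isSingleton P w₀ ≡ true
      singleton = singleton-true {S = P} (preimage-singleton w₀)
      holds : condition a P w₀ ≡ true
      holds rewrite label-arc w₀ | inNeighbourhood | singleton = refl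

    fLab-image : ∀ a → image g a ≡ true → fLab adj s a (preimage (lookup g) a) ≡ labelTerm a (labelOf a) ∷ []
    fLab-image a h with image-elim g a h
    ... | w , refl rewrite labelOf-lookup w = fLab-label w

    good-term : (m : Monomial (Var k)) (C : Arc → Bool) → (∀ a → C a ≡ image g a) →
                cnt m (coverTerm C g) ≡ monoEq m (labelingMonomial g) ⊙ 1
    good-term m C e = trans (cong (cnt m) (Πₚ-single-filter allArcs C _ μ (λ a ca → fLab-image a (trans (sym (e a)) ca))))
                            (trans (cnt-single m _) (cong (_⊙ 1) (monoEq-cong m exponents)))
      where
      μ : Arc → Monomial (Var k)
      μ a = labelTerm a (labelOf a)
      exponents : ∀ y → prodMono (filterᵇ C allArcs) μ y ≡ labelingMonomial g y
      exponents y = begin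
          prodMono (filterᵇ C allArcs) μ y ≡⟨ prodMono-∑ (filterᵇ C allArcs) μ y ⟩
          ∑ (filterᵇ C allArcs) (λ a → μ a y) ≡⟨ ∑-filter allArcs C _ ⟩
          ∑ allArcs (λ a → C a ⊙ μ a y) ≡⟨ ∑-cong allArcs (λ a → cong (_⊙ μ a y) (e a)) ⟩
          ∑ allArcs (λ a → image g a ⊙ μ a y)
            ≡⟨ ∑-bijection EArc EF (image g) (λ _ → true) (λ a → μ a y) (λ w → labelTerm (lookup g w) w y) labelOf (lookup g)
                   (λ _ _ → refl) (λ w _ → image-intro g w) lookup-labelOf (λ w _ → labelOf-lookup w)
                   (λ a h → cong (λ z → labelTerm z (labelOf a) y) (sym (lookup-labelOf a h))) ⟩
          ∑ (allFin k) (λ w → labelTerm (lookup g w) w y) ∎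
        where open ≡-Reasoning

  -- two labels on one arc: the factor of that arc sees no singleton preimage
  repeated-label-vanishes : ∀ C g a b → a ≢ b → lookup g a ≡ lookup g b → C (lookup g a) ≡ true → coverTerm C g ≡ []
  repeated-label-vanishes C g a b a≢b gab ca =
    Πₚ-zero-filter allArcs C (coverFactor g) (mem EArc A₀) ca (fLab-zero A₀ P (λ w → condition-nonsingleton A₀ P w (notSingleton w)))
    where
    A₀ : Arc
    A₀ = lookup g a
    P : Vec Bool k
    P = preimage (lookup g) A₀
    notSingleton : ∀ w → isSingleton P w ≡ false
    notSingleton w with finEq a w in ew
    ... | true = singleton-false {S = P} {w' = b}
                   (trans (preimage-lookup g A₀ b) (subst (λ z → arcEq z A₀ ≡ true) gab (arcEq-refl A₀)))
                   (finEq-false (λ e → a≢b (trans (finEq-sound ew) (sym e))))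
    ... | false = singleton-false {S = P} {w' = a} (trans (preimage-lookup g A₀ a) (arcEq-refl A₀)) ew

  bad-label-vanishes : ∀ C g w → isCycleCover (arcF adj) C ≡ true → C (lookup g w) ≡ true → labelOK g w ≡ false → coverTerm C g ≡ []
  bad-label-vanishes C g w cc cw bad = Πₚ-zero-filter allArcs C (coverFactor g) (mem EArc A₀) cw (fLab-zero A₀ P noLabel)
    where
    A₀ : Arc
    A₀ = lookup g w
    P : Vec Bool k
    P = preimage (lookup g) A₀
    distinct : not (finEq (γ g w) (β g w)) ≡ true
    distinct = ∧-true₁ (Cover.arcs cc A₀ cw)
    notNeighbour : inN adj (γ g w) (β g w) w ≡ false
    notNeighbour = ∧t-false distinct bad
    noLabel : ∀ w' → condition A₀ P w' ≡ false
    noLabel w' with finEq w w' in same-iterate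
    ... | true rewrite sym (finEq-sound same-iterate) | notNeighbour = BP.∧-zeroʳ _
    ... | false = condition-nonsingleton A₀ P w' (singleton-false {S = P} {w' = w} (trans (preimage-lookup g A₀ w) (arcEq-refl A₀)) same-iterate)

  module InjectiveLabels (C : Arc → Bool) (g : Labeling) (cc : isCycleCover (arcF adj) C ≡ true)
                         (onC : ∀ w → C (lookup g w) ≡ true)
                         (label-injective : ∀ {w₁ w₂} → lookup g w₁ ≡ lookup g w₂ → w₁ ≡ w₂) where
    γ-injective : Inj (γ g)
    γ-injective {w₁} {w₂} e with β g w₁ Data.Fin.≟ β g w₂
    ... | yes eb = label-injective (cong₂ _,_ e eb)
    ... | no nb = ⊥-elim (1+n≰n (subst (2 ≤_) (Cover.outdeg cc (γ g w₁))
                    (count-two (λ v → C (γ g w₁ , v)) _ _ nb (onC w₁) (subst (λ z → C (z , β g w₂) ≡ true) (sym e) (onC w₂)))))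

    β-injective : Inj (β g)
    β-injective {w₁} {w₂} e with γ g w₁ Data.Fin.≟ γ g w₂
    ... | yes eg = label-injective (cong₂ _,_ eg e)
    ... | no ng = ⊥-elim (1+n≰n (subst (2 ≤_) (Cover.indeg cc (β g w₁))
                    (count-two (λ u → C (u , β g w₁)) _ _ ng (onC w₁) (subst (λ z → C (γ g w₂ , z) ≡ true) (sym e) (onC w₂)))))

  labelsInjectiveᵇ : Labeling → Bool
  labelsInjectiveᵇ g = allᵇ (allFin k) (λ a → allᵇ (allFin k) (λ b → not (arcEq (lookup g a) (lookup g b)) ∨ finEq a b))

  non-good-vanishes : ∀ C g → isCycleCover (arcF adj) C ≡ true → isSurjOnto C (lookup g) ≡ true → Good g ≡ false → coverTerm C g ≡ []
  non-good-vanishes C g cc sj bad = bool-case (labelsInjectiveᵇ g) injective repeated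
    where
    repeated : labelsInjectiveᵇ g ≡ false → coverTerm C g ≡ []
    repeated ei with all-false-elim (allFin k) ei
    ... | a , _ , e1 with all-false-elim (allFin k) e1
    ... | b , _ , e2 = repeated-label-vanishes C g a b a≢b (arcEq-sound (proj₁ (not∨-false e2))) (surj-label C g sj a)
      where
      a≢b : a ≢ b
      a≢b e = t≢f (trans (sym (subst (λ z → finEq a z ≡ true) e (finEq-refl a))) (proj₂ (not∨-false e2)))
    injective : labelsInjectiveᵇ g ≡ true → coverTerm C g ≡ []
    injective ei = bool-case (allᵇ (allFin k) (labelOK g)) allOK someBad
      where
      label-injective : ∀ {w₁ w₂} → lookup g w₁ ≡ lookup g w₂ → w₁ ≡ w₂
      label-injective {w₁} {w₂} e with finEq w₁ w₂ in ew
      ... | true = finEq-sound ew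
      ... | false = ⊥-elim (t≢f (sym (trans (sym ew) (∨-elim-not (all-true (all-true ei (∈-allFin w₁)) (∈-allFin w₂))
                          (subst (λ z → arcEq (lookup g w₁) z ≡ true) e (arcEq-refl (lookup g w₁)))))))
      open InjectiveLabels C g cc (surj-label C g sj) label-injective
      allOK : allᵇ (allFin k) (labelOK g) ≡ true → coverTerm C g ≡ []
      allOK el = ⊥-elim (t≢f (trans (sym (good-complete g record { labelsOK = λ w → all-true el (∈-allFin w)
                                                                  ; γinj = γ-injective ; βinj = β-injective })) bad))
      someBad : allᵇ (allFin k) (labelOK g) ≡ false → coverTerm C g ≡ []
      someBad el = let (w , _ , ew) = all-false-elim (allFin k) el in bad-label-vanishes C g w cc (surj-label C g sj w) ew

  -- Step 1: the count of m in Λ is the number of good labelings with monomial m.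

  ECode : Enum (Vec Bool (k * k))
  ECode = EVec EBool (k * k)

  cover-labeling-term : ∀ m χ g →
    isCycleCover (arcF adj) (arcSetOf χ) ⊙ isSurjOnto (arcSetOf χ) (lookup g) ⊙ cnt m (coverTerm (arcSetOf χ) g)
      ≡ eq ECode (imageCode g) χ ⊙ (Good g ⊙ monoEq m (labelingMonomial g) ⊙ 1)
  cover-labeling-term m χ g with Good g in eg
  ... | false with isCycleCover (arcF adj) (arcSetOf χ) in e1 | isSurjOnto (arcSetOf χ) (lookup g) in e2
  ... | true | true = trans (cong (cnt m) (non-good-vanishes (arcSetOf χ) g e1 e2 eg)) (sym (⊙-0 (eq ECode (imageCode g) χ)))
  ... | true | false = sym (⊙-0 (eq ECode (imageCode g) χ))
  ... | false | _ = sym (⊙-0 (eq ECode (imageCode g) χ))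
  cover-labeling-term m χ g | true with good-sound g eg
  ... | gp with isCycleCover (arcF adj) (arcSetOf χ) in e1 | isSurjOnto (arcSetOf χ) (lookup g) in e2
  ... | true | true rewrite sym (imageCode-unique χ g (surj-image (arcSetOf χ) g e2)) | eq-refl ECode χ =
          GoodLabeling.good-term g gp m (arcSetOf χ) (surj-image (arcSetOf χ) g e2)
  ... | true | false = sym (cong (λ b → b ⊙ (monoEq m (labelingMonomial g) ⊙ 1)) (eq-false ECode {imageCode g} {χ} ne))
    where
    ne : imageCode g ≢ χ
    ne e = t≢f (trans (sym (image-surj (arcSetOf (imageCode g)) g (arcSetOf-imageCode g)))
                      (trans (cong (λ z → isSurjOnto (arcSetOf z) (lookup g)) e) e2))
  ... | false | _ = sym (cong (λ b → b ⊙ (monoEq m (labelingMonomial g) ⊙ 1)) (eq-false ECode {imageCode g} {χ} ne))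
    where
    ne : imageCode g ≢ χ
    ne e = t≢f (trans (sym (trans (isCycleCover-cong (arcF adj) _ _ (arcSetOf-imageCode g)) (GoodLabeling.image-cover g gp)))
                      (trans (cong (λ z → isCycleCover (arcF adj) (arcSetOf z)) e) e1))

  Λ-count : ∀ m → cnt m (ΛG adj s) ≡ ∑ (list ELabeling) (λ g → Good g ⊙ monoEq m (labelingMonomial g) ⊙ 1)
  Λ-count m = begin
      cnt m (ΛG adj s)
        ≡⟨ cnt-Σₚ m (GF2.cc k k (arcF adj)) _ ⟩
      ∑ (GF2.cc k k (arcF adj)) (λ C → cnt m (Σₚ (GF2.surj k k k C) (λ g → Πₚ (filterᵇ C allArcs) (λ a → fLab adj s a (GF2.preimage k k g a)))))
        ≡⟨ ∑-cong (GF2.cc k k (arcF adj)) (λ C → cnt-Σₚ m (GF2.surj k k k C) _) ⟩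
      ∑ (GF2.cc k k (arcF adj)) (λ C → ∑ (GF2.surj k k k C) (λ g → cnt m (Πₚ (filterᵇ C allArcs) (λ a → fLab adj s a (GF2.preimage k k g a)))))
        ≡⟨ ∑-filter (GF2.allArcSets k k) (isCycleCover (arcF adj)) _ ⟩
      ∑ (GF2.allArcSets k k) (λ C → isCycleCover (arcF adj) C ⊙ ∑ (GF2.surj k k k C) (λ g → cnt m (Πₚ (filterᵇ C allArcs) (λ a → fLab adj s a (GF2.preimage k k g a)))))
        ≡⟨ ∑-map (list ECode) arcSetOf _ ⟩
      ∑ (list ECode) (λ χ → isCycleCover (arcF adj) (arcSetOf χ) ⊙ ∑ (GF2.surj k k k (arcSetOf χ)) (λ g → cnt m (Πₚ (filterᵇ (arcSetOf χ) allArcs) (λ a → fLab adj s a (GF2.preimage k k g a)))))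
        ≡⟨ ∑-cong (list ECode) (λ χ → cong (isCycleCover (arcF adj) (arcSetOf χ) ⊙_)
             (trans (∑-filter (allFunsFin allArcs k) (isSurjOnto (arcSetOf χ)) _) (∑-map (list ELabeling) lookup _))) ⟩
      ∑ (list ECode) (λ χ → isCycleCover (arcF adj) (arcSetOf χ) ⊙ ∑ (list ELabeling) (λ g → isSurjOnto (arcSetOf χ) (lookup g) ⊙ cnt m (coverTerm (arcSetOf χ) g)))
        ≡⟨ ∑-cong (list ECode) (λ χ → sym (∑-⊙ (list ELabeling) _ _)) ⟩
      ∑ (list ECode) (λ χ → ∑ (list ELabeling) (λ g → isCycleCover (arcF adj) (arcSetOf χ) ⊙ isSurjOnto (arcSetOf χ) (lookup g) ⊙ cnt m (coverTerm (arcSetOf χ) g)))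
        ≡⟨ ∑-swap (list ECode) (list ELabeling) _ ⟩
      ∑ (list ELabeling) (λ g → ∑ (list ECode) (λ χ → isCycleCover (arcF adj) (arcSetOf χ) ⊙ isSurjOnto (arcSetOf χ) (lookup g) ⊙ cnt m (coverTerm (arcSetOf χ) g)))
        ≡⟨ ∑-cong (list ELabeling) (λ g → trans (∑-cong (list ECode) (λ χ → cover-labeling-term m χ g))
                                                (delta ECode (imageCode g) (λ _ → Good g ⊙ monoEq m (labelingMonomial g) ⊙ 1))) ⟩
      ∑ (list ELabeling) (λ g → Good g ⊙ monoEq m (labelingMonomial g) ⊙ 1) ∎
    where open ≡-Reasoning

  -- Step 2: Hamiltonian cycles are good labelings with a single ν-cycle.

  unV : Vtx k → Fin k
  unV = [ (λ u → u) , (λ w → w) ]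

  Successor : Set
  Successor = Vec (Vtx k) k × Vec (Vtx k) k

  EHalf : Enum (Vec (Vtx k) k)
  EHalf = EVec (EVtx k) k

  ESuccessor : Enum Successor
  ESuccessor = EProd EHalf EHalf

  successor : Successor → Vtx k → Vtx k
  successor p = [ lookup (proj₁ p) , lookup (proj₂ p) ]

  edgeMonomial : Vtx k → Vtx k → Monomial (Var k)
  edgeMonomial (inj₁ u) (inj₂ w) = indicator (xIn u w)
  edgeMonomial (inj₂ w) (inj₁ u) = indicator (xOut w u)
  edgeMonomial (inj₁ _) (inj₁ _) = λ _ → 0
  edgeMonomial (inj₂ _) (inj₂ _) = λ _ → 0

  x-edgeMonomial : ∀ v t → edge adj v t ≡ true → x s v t ≡ edgeMonomial v t ∷ []
  x-edgeMonomial (inj₁ u) (inj₂ w) _ = refl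
  x-edgeMonomial (inj₂ w) (inj₁ u) _ = xOut-eq w u

  cycleMonomial : (Vtx k → Vtx k) → Monomial (Var k)
  cycleMonomial σ y = ∑ (allVtx k) (λ v → edgeMonomial v (σ v) y)

  edge-from-V₁ : ∀ u t → edge adj (inj₁ u) t ≡ true → t ≡ inj₂ (unV t)
  edge-from-V₁ u (inj₂ w) _ = refl

  edge-from-V₂ : ∀ w t → edge adj (inj₂ w) t ≡ true → t ≡ inj₁ (unV t)
  edge-from-V₂ w (inj₁ u) _ = refl

  module IsHam {σ : Vtx k → Vtx k} (h : isHam adj s σ ≡ true) where
    long : (3 ≤ᵇ (k + k)) ≡ true
    long = ∧-true₁ h

    edges : ∀ v → edge adj v (σ v) ≡ true
    edges v = all-true (∧-true₁ (∧-true₂ {3 ≤ᵇ (k + k)} h)) (mem (EVtx k) v)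

    covers : ∀ v → anyᵇ (upTo (k + k)) (λ i → vtxEq (iter σ i (inj₁ s)) v) ≡ true
    covers v = all-true (∧-true₁ (∧-true₂ {allᵇ (allVtx k) (λ v → edge adj v (σ v))} (∧-true₂ {3 ≤ᵇ (k + k)} h)))
                        (mem (EVtx k) v)

    closes : vtxEq (iter σ (k + k) (inj₁ s)) (inj₁ s) ≡ true
    closes = ∧-true₂ {allᵇ (allVtx k) (λ v → anyᵇ (upTo (k + k)) (λ i → vtxEq (iter σ i (inj₁ s)) v))}
               (∧-true₂ {allᵇ (allVtx k) (λ v → edge adj v (σ v))} (∧-true₂ {3 ≤ᵇ (k + k)} h))

  hamSum-count : ∀ m → cnt m (hamSum adj s) ≡ ∑ (list ESuccessor) (λ p → isHam adj s (successor p) ⊙ monoEq m (cycleMonomial (successor p)) ⊙ 1)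
  hamSum-count m = begin
      cnt m (hamSum adj s) ≡⟨ cnt-Σₚ m (hc adj s) _ ⟩
      ∑ (hc adj s) (λ σ → cnt m (Πₚ (allVtx k) (λ v → x s v (σ v)))) ≡⟨ ∑-filter (allVtxFuns k) (isHam adj s) _ ⟩
      ∑ (allVtxFuns k) (λ σ → isHam adj s σ ⊙ cnt m (Πₚ (allVtx k) (λ v → x s v (σ v))))
        ≡⟨ ∑-concatMap (allFunsFin (allVtx k) k) _ _ ⟩
      _ ≡⟨ ∑-map (list EHalf) lookup _ ⟩
      _ ≡⟨ ∑-cong (list EHalf) (λ v1 → trans (∑-map (allFunsFin (allVtx k) k) _ _) (∑-map (list EHalf) lookup _)) ⟩
      ∑ (list EHalf) (λ v1 → ∑ (list EHalf) (λ v2 → isHam adj s (successor (v1 , v2)) ⊙ cnt m (Πₚ (allVtx k) (λ v → x s v (successor (v1 , v2) v)))))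
        ≡⟨ sym (∑-cart (list EHalf) (list EHalf) _) ⟩
      ∑ (list ESuccessor) (λ p → isHam adj s (successor p) ⊙ cnt m (Πₚ (allVtx k) (λ v → x s v (successor p v))))
        ≡⟨ ∑-cong (list ESuccessor) term ⟩
      ∑ (list ESuccessor) (λ p → isHam adj s (successor p) ⊙ monoEq m (cycleMonomial (successor p)) ⊙ 1) ∎
    where
    open ≡-Reasoning
    term : ∀ p → isHam adj s (successor p) ⊙ cnt m (Πₚ (allVtx k) (λ v → x s v (successor p v))) ≡ isHam adj s (successor p) ⊙ monoEq m (cycleMonomial (successor p)) ⊙ 1
    term p with isHam adj s (successor p) in eh
    ... | false = refl
    ... | true = trans (cong (cnt m) (Πₚ-single (allVtx k) _ (λ v → edgeMonomial v (successor p v)) (λ v → x-edgeMonomial v (successor p v) (IsHam.edges eh v))))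
                       (trans (cnt-single m _) (cong (_⊙ 1) (monoEq-cong m (λ y → prodMono-∑ (allVtx k) _ y))))

  ν : Labeling → Fin k → Fin k
  ν g w = inv (γ g) (β g w)

  ws : Labeling → Fin k
  ws g = inv (γ g) s

  SingleCycle : Labeling → Bool
  SingleCycle g = allᵇ (allFin k) (inOrbit (ν g) (ws g))

  -- the labeling of a successor map: label w sits on σ⁻¹(w) → σ(w)
  forwardOf : Successor → Fin k → Fin k
  forwardOf p u = unV (lookup (proj₁ p) u)

  backOf : Successor → Fin k → Fin k
  backOf p w = unV (lookup (proj₂ p) w)

  labelingOf : Successor → Labeling
  labelingOf p = tabulate (λ w → (inv (forwardOf p) w , backOf p w))

  successorOf : Labeling → Successor
  successorOf g = tabulate (λ u → inj₂ (inv (γ g) u)) , tabulate (λ w → inj₁ (β g w))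

  -- A Hamiltonian cycle σ alternates sides: σ = α on V₁, β on V₂, and
  -- ρ = β ∘ α is a single cycle on V₁.  Its labeling is good and single-cycle.
  module FromCycle (p : Successor) (eh : isHam adj s (successor p) ≡ true) where
    σ : Vtx k → Vtx k
    σ = successor p
    α : Fin k → Fin k
    α = forwardOf p
    βσ : Fin k → Fin k
    βσ = backOf p
    open IsHam eh

    two≤k : 2 ≤ k
    two≤k = half-of-three k (≤ᵇ⇒≤ 3 (k + k) (Equivalence.from BP.T-≡ long))

    σ₁ : ∀ u → σ (inj₁ u) ≡ inj₂ (α u)
    σ₁ u = edge-from-V₁ u _ (edges (inj₁ u))
    σ₂ : ∀ w → σ (inj₂ w) ≡ inj₁ (βσ w)
    σ₂ w = edge-from-V₂ w _ (edges (inj₂ w))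

    ρ : Fin k → Fin k
    ρ u = βσ (α u)

    iter-even : ∀ j → iter σ (j + j) (inj₁ s) ≡ inj₁ (iter ρ j s)
    iter-odd : ∀ j → iter σ (suc (j + j)) (inj₁ s) ≡ inj₂ (α (iter ρ j s))
    iter-even zero = refl
    iter-even (suc j) = trans (cong (λ z → iter σ (suc z) (inj₁ s)) (+-suc j j))
                        (trans (cong σ (iter-odd j)) (σ₂ _))
    iter-odd j = trans (cong σ (iter-even j)) (σ₁ _)

    reach-V₁ : ∀ u → ∃[ j ] (j < k × iter ρ j s ≡ u)
    reach-V₁ u with any-elim (upTo (k + k)) (covers (inj₁ u))
    ... | i , mi , ei with parity i
    ... | j , inj₁ refl = j , half< j (∈-upTo⁻ mi) , SumP.inj₁-injective (trans (sym (iter-even j)) (vtxEq-sound ei))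
    ... | j , inj₂ refl = ⊥-elim (bad (trans (sym (iter-odd j)) (vtxEq-sound ei)))
      where bad : ∀ {a b} → inj₂ {A = Fin k} a ≢ inj₁ b
            bad ()

    reach-V₂ : ∀ w → ∃[ j ] (j < k × α (iter ρ j s) ≡ w)
    reach-V₂ w with any-elim (upTo (k + k)) (covers (inj₂ w))
    ... | i , mi , ei with parity i
    ... | j , inj₂ refl = j , half< j (<-trans (n<1+n _) (∈-upTo⁻ mi)) , SumP.inj₂-injective (trans (sym (iter-odd j)) (vtxEq-sound ei))
    ... | j , inj₁ refl = ⊥-elim (bad (trans (sym (iter-even j)) (vtxEq-sound ei)))
      where bad : ∀ {a b} → inj₁ {B = Fin k} a ≢ inj₂ b
            bad ()

    ρ-period : iter ρ k s ≡ s
    ρ-period = SumP.inj₁-injective (trans (sym (iter-even k)) (vtxEq-sound closes))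

    -- hence α and β are onto, so bijective
    αs : Surj α
    αs w = let (j , _ , e) = reach-V₂ w in iter ρ j s , e

    βs : Surj βσ
    βs u with reach-V₁ u
    ... | zero , _ , e = α (iter ρ (k ∸ 1) s) , trans (trans (cong (λ z → iter ρ z s) (m+[n∸m]≡n (≤-trans (s≤s z≤n) two≤k))) ρ-period) e
    ... | suc j , _ , e = α (iter ρ j s) , e

    αinj : Inj α
    αinj = surj→inj α αs
    βinj : Inj βσ
    βinj = surj→inj βσ βs
    ρinj : Inj ρ
    ρinj e = αinj (βinj e)

    open Orbits ρ ρinj using (it-comm; it-inj)

    it-fix : ρ s ≡ s → ∀ j → iter ρ j s ≡ s
    it-fix e zero = refl
    it-fix e (suc j) = trans (cong ρ (it-fix e j)) e

    -- ρ has no fixed point, since its single cycle has length k ≥ 2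
    ρ-nofix : ∀ u → ρ u ≢ u
    ρ-nofix u e with reach-V₁ u
    ... | j , _ , eu = ne (trans (sym eo) (it-fix ρs (proj₁ (reach-V₁ o))))
      where
      ρs : ρ s ≡ s
      ρs = it-inj j (trans (it-comm j 1 s) (trans (cong ρ eu) (trans e (sym eu))))
      o : Fin k
      o = proj₁ (another two≤k s)
      ne : o ≢ s
      ne = proj₂ (another two≤k s)
      eo : iter ρ (proj₁ (reach-V₁ o)) s ≡ o
      eo = proj₂ (proj₂ (reach-V₁ o))

    gφ : Labeling
    gφ = labelingOf p

    γφ : ∀ w → γ gφ w ≡ inv α w
    γφ w = cong proj₁ (VP.lookup∘tabulate (λ w → (inv α w , βσ w)) w)
    βφ : ∀ w → β gφ w ≡ βσ w
    βφ w = cong proj₂ (VP.lookup∘tabulate (λ w → (inv α w , βσ w)) w)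

    adj1 : ∀ u → adj u (α u) ≡ true
    adj1 u = subst (λ t → edge adj (inj₁ u) t ≡ true) (σ₁ u) (edges (inj₁ u))
    adj2 : ∀ w → adj (βσ w) w ≡ true
    adj2 w = subst (λ t → edge adj (inj₂ w) t ≡ true) (σ₂ w) (edges (inj₂ w))

    labelingOf-good : IsGood gφ
    labelingOf-good = record { labelsOK = labels-ok ; γinj = γ-injective ; βinj = β-injective }
      where
      labels-ok : ∀ w → labelOK gφ w ≡ true
      labels-ok w = subst₂ (λ u v → (inN adj u v w ∧ not (finEq u v)) ≡ true) (sym (γφ w)) (sym (βφ w))
               (∧-intro (∧-intro (subst (λ z → adj (inv α w) z ≡ true) (inv-r α αs w) (adj1 (inv α w))) (adj2 w))
                        (cong not (finEq-false (λ e → ρ-nofix (inv α w) (sym (trans e (cong βσ (sym (inv-r α αs w)))))))))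
      γ-injective : Inj (γ gφ)
      γ-injective {a} {b} e = inv-inj α αs (trans (sym (γφ a)) (trans e (γφ b)))
      β-injective : Inj (β gφ)
      β-injective {a} {b} e = βinj (trans (sym (βφ a)) (trans e (βφ b)))

    invγφ : ∀ x → inv (γ gφ) x ≡ α x
    invγφ x = trans (inv-cong (γ gφ) (inv α) γφ x) (inv-inv α αinj x)

    νφ-it : ∀ j → iter (ν gφ) j (ws gφ) ≡ α (iter ρ j s)
    νφ-it zero = invγφ s
    νφ-it (suc j) = trans (cong (ν gφ) (νφ-it j)) (trans (invγφ _) (cong α (βφ _)))

    labelingOf-single : SingleCycle gφ ≡ true
    labelingOf-single = all-intro (allFin k) (λ {w} _ → let (j , j<k , e) = reach-V₂ w in
              any-intro (∈-upTo⁺ j<k) (subst (λ z → finEq z w ≡ true) (sym (trans (νφ-it j) e)) (finEq-refl w)))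

    successorOf-labelingOf : successorOf gφ ≡ p
    successorOf-labelingOf = cong₂ _,_ (trans (VP.tabulate-cong (λ u → trans (cong inj₂ (invγφ u)) (sym (σ₁ u)))) (VP.tabulate∘lookup (proj₁ p)))
                   (trans (VP.tabulate-cong (λ w → trans (cong inj₁ (βφ w)) (sym (σ₂ w)))) (VP.tabulate∘lookup (proj₂ p)))

    labelingOf-monomial : ∀ y → cycleMonomial σ y ≡ labelingMonomial gφ y
    labelingOf-monomial y = begin
        cycleMonomial σ y ≡⟨ ∑-vtx k _ ⟩
        ∑ (allFin k) (λ u → edgeMonomial (inj₁ u) (σ (inj₁ u)) y) + ∑ (allFin k) (λ w → edgeMonomial (inj₂ w) (σ (inj₂ w)) y)
          ≡⟨ cong₂ _+_ (∑-cong (allFin k) (λ u → cong (λ t → edgeMonomial (inj₁ u) t y) (σ₁ u))) (∑-cong (allFin k) (λ w → cong (λ t → edgeMonomial (inj₂ w) t y) (σ₂ w))) ⟩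
        ∑ (allFin k) (λ u → indicator (xIn u (α u)) y) + ∑ (allFin k) (λ w → indicator (xOut w (βσ w)) y)
          ≡⟨ cong (_+ ∑ (allFin k) (λ w → indicator (xOut w (βσ w)) y))
                  (∑-bijection EF EF (λ _ → true) (λ _ → true) (λ u → indicator (xIn u (α u)) y) (λ w → indicator (xIn (inv α w) w) y) α (inv α)
                       (λ _ _ → refl) (λ _ _ → refl) (λ u _ → inv-l α αinj u) (λ w _ → inv-r α αs w)
                       (λ u _ → cong (λ z → indicator (xIn z (α u)) y) (sym (inv-l α αinj u)))) ⟩
        ∑ (allFin k) (λ w → indicator (xIn (inv α w) w) y) + ∑ (allFin k) (λ w → indicator (xOut w (βσ w)) y)
          ≡⟨ sym (∑-+ (allFin k) _ _) ⟩
        ∑ (allFin k) (λ w → indicator (xIn (inv α w) w) y + indicator (xOut w (βσ w)) y)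
          ≡⟨ ∑-cong (allFin k) (λ w → sym (cong₂ (λ a b → indicator (xIn a w) y + indicator (xOut w b) y) (γφ w) (βφ w))) ⟩
        labelingMonomial gφ y ∎
      where open ≡-Reasoning

  module GoodPermutations (g : Labeling) (gp : IsGood g) where
    open IsGood gp public
    γs : Surj (γ g)
    γs = inj→surj (γ g) γinj
    γi : Fin k → Fin k
    γi = inv (γ g)
    νinj : Inj (ν g)
    νinj e = βinj (inv-inj (γ g) γs e)
    adjγ : ∀ w → adj (γ g w) w ≡ true
    adjγ w = ∧-true₁ (∧-true₁ (labelsOK w))
    adjβ : ∀ w → adj (β g w) w ≡ true
    adjβ w = ∧-true₂ {a = adj (γ g w) w} (∧-true₁ (labelsOK w))
    γβne : ∀ w → γ g w ≢ β g w
    γβne w e = t≢f (trans (sym (∧-true₂ {a = inN adj (γ g w) (β g w) w} (labelsOK w))) (cong not (subst (λ z → finEq (γ g w) z ≡ true) e (finEq-refl _))))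
    γν : ∀ w → γ g (ν g w) ≡ β g w
    γν w = inv-r (γ g) γs (β g w)
    two≤k : 2 ≤ k
    two≤k = two≤ (γβne s)

    module SingleCycleFacts (hl : SingleCycle g ≡ true) where
      reaches : ∀ w → ∃[ j ] (j < k × iter (ν g) j (ws g) ≡ w)
      reaches w with any-elim (upTo k) (all-true hl (∈-allFin w))
      ... | j , mj , ej = j , ∈-upTo⁻ mj , finEq-sound ej

      -- j ↦ νʲ w_s is onto, hence injective, on Fin k
      orbitMap : Fin k → Fin k
      orbitMap j = iter (ν g) (toℕ j) (ws g)
      orbitMap-onto : Surj orbitMap
      orbitMap-onto w = let (j , j<k , e) = reaches w in fromℕ< j<k , trans (cong (λ z → iter (ν g) z (ws g)) (FP.toℕ-fromℕ< j<k)) e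
      orbitMap-injective : Inj orbitMap
      orbitMap-injective = surj→inj orbitMap orbitMap-onto

      k-1<k : k ∸ 1 < k
      k-1<k = subst (k ∸ 1 <_) (m+[n∸m]≡n (≤-trans (s≤s z≤n) two≤k)) (n<1+n _)

      -- νᵏ w_s is some νʲ w_s with j < k; j = j' + 1 would force j' = k - 1
      ν-period : iter (ν g) k (ws g) ≡ ws g
      ν-period with reaches (iter (ν g) k (ws g))
      ... | zero , _ , e = sym e
      ... | suc j , j<k , e = ⊥-elim (<-irrefl (trans (cong suc j≡k-1) (m+[n∸m]≡n (≤-trans (s≤s z≤n) two≤k))) j<k)
        where
        unfold-last : iter (ν g) k (ws g) ≡ ν g (iter (ν g) (k ∸ 1) (ws g))
        unfold-last = cong (λ z → iter (ν g) z (ws g)) (sym (m+[n∸m]≡n (≤-trans (s≤s z≤n) two≤k)))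
        same-iterate : iter (ν g) j (ws g) ≡ iter (ν g) (k ∸ 1) (ws g)
        same-iterate = νinj (trans e unfold-last)
        j<k' : j < k
        j<k' = <-trans (n<1+n j) j<k
        j≡k-1 : j ≡ k ∸ 1
        j≡k-1 = trans (sym (FP.toℕ-fromℕ< j<k')) (trans (cong toℕ (orbitMap-injective {fromℕ< j<k'} {fromℕ< k-1<k}
                 (trans (cong (λ z → iter (ν g) z (ws g)) (FP.toℕ-fromℕ< j<k'))
                 (trans same-iterate (cong (λ z → iter (ν g) z (ws g)) (sym (FP.toℕ-fromℕ< k-1<k)))))))
                 (FP.toℕ-fromℕ< k-1<k))

  module ToCycle (g : Labeling) (gp : IsGood g) (hl : SingleCycle g ≡ true) where
    open GoodPermutations g gp
    open SingleCycleFacts hl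
    σ' : Vtx k → Vtx k
    σ' = successor (successorOf g)
    σ'₁ : ∀ u → σ' (inj₁ u) ≡ inj₂ (γi u)
    σ'₁ u = VP.lookup∘tabulate (λ u → inj₂ (γi u)) u
    σ'₂ : ∀ w → σ' (inj₂ w) ≡ inj₁ (β g w)
    σ'₂ w = VP.lookup∘tabulate (λ w → inj₁ (β g w)) w

    iter-even : ∀ j → iter σ' (j + j) (inj₁ s) ≡ inj₁ (γ g (iter (ν g) j (ws g)))
    iter-odd : ∀ j → iter σ' (suc (j + j)) (inj₁ s) ≡ inj₂ (iter (ν g) j (ws g))
    iter-even zero = cong inj₁ (sym (inv-r (γ g) γs s))
    iter-even (suc j) = trans (cong (λ z → iter σ' (suc z) (inj₁ s)) (+-suc j j))
                        (trans (cong σ' (iter-odd j)) (trans (σ'₂ _) (cong inj₁ (sym (γν _)))))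
    iter-odd j = trans (cong σ' (iter-even j)) (trans (σ'₁ _) (cong inj₂ (inv-l (γ g) γinj _)))

    ham : isHam adj s σ' ≡ true
    ham = ∧-intro (Equivalence.to BP.T-≡ (≤⇒≤ᵇ (≤-trans (s≤s (s≤s (s≤s z≤n))) (+-mono-≤ two≤k two≤k))))
          (∧-intro (all-intro (allVtx k) (λ {v} _ → edges-ok v))
          (∧-intro (all-intro (allVtx k) (λ {v} _ → covers-all v)) closes-up))
      where
      edges-ok : ∀ v → edge adj v (σ' v) ≡ true
      edges-ok (inj₁ u) rewrite σ'₁ u = subst (λ z → adj z (γi u) ≡ true) (inv-r (γ g) γs u) (adjγ (γi u))
      edges-ok (inj₂ w) rewrite σ'₂ w = adjβ w
      covers-all : ∀ v → anyᵇ (upTo (k + k)) (λ i → vtxEq (iter σ' i (inj₁ s)) v) ≡ true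
      covers-all (inj₁ u) with reaches (γi u)
      ... | j , j<k , e = any-intro (∈-upTo⁺ (+-mono-< j<k j<k))
                            (subst (λ z → vtxEq z (inj₁ u) ≡ true) (sym (trans (iter-even j) (cong inj₁ (trans (cong (γ g) e) (inv-r (γ g) γs u))))) (vtxEq-refl _))
      covers-all (inj₂ w) with reaches w
      ... | j , j<k , e = any-intro (∈-upTo⁺ (≤-trans (s≤s (≤-reflexive (sym (+-suc j j)))) (+-mono-≤ j<k j<k)))
                            (subst (λ z → vtxEq z (inj₂ w) ≡ true) (sym (trans (iter-odd j) (cong inj₂ e))) (vtxEq-refl _))
      closes-up : vtxEq (iter σ' (k + k) (inj₁ s)) (inj₁ s) ≡ true
      closes-up = subst (λ z → vtxEq z (inj₁ s) ≡ true) (sym (trans (iter-even k) (cong inj₁ (trans (cong (γ g) ν-period) (inv-r (γ g) γs s))))) (vtxEq-refl _)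

    labelingOf-successorOf : labelingOf (successorOf g) ≡ g
    labelingOf-successorOf = trans (VP.tabulate-cong same-arc) (VP.tabulate∘lookup g)
      where
      αψ : ∀ u → forwardOf (successorOf g) u ≡ γi u
      αψ u = cong unV (σ'₁ u)
      same-arc : ∀ w → (inv (forwardOf (successorOf g)) w , backOf (successorOf g) w) ≡ lookup g w
      same-arc w = cong₂ _,_ (trans (inv-cong _ _ αψ w) (inv-inv (γ g) γinj w)) (cong unV (σ'₂ w))

  cycles-are-labelings : ∀ m → ∑ (list ESuccessor) (λ p → isHam adj s (successor p) ⊙ monoEq m (cycleMonomial (successor p)) ⊙ 1)
                 ≡ ∑ (list ELabeling) (λ g → (Good g ∧ SingleCycle g) ⊙ monoEq m (labelingMonomial g) ⊙ 1)
  cycles-are-labelings m = ∑-bijection ESuccessor ELabeling (λ p → isHam adj s (successor p)) (λ g → Good g ∧ SingleCycle g)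
                 (λ p → monoEq m (cycleMonomial (successor p)) ⊙ 1) (λ g → monoEq m (labelingMonomial g) ⊙ 1) labelingOf successorOf
                 (λ p e → ∧-intro (good-complete _ (FromCycle.labelingOf-good p e)) (FromCycle.labelingOf-single p e))
                 (λ g e → ToCycle.ham g (good-sound g (∧-true₁ e)) (∧-true₂ e))
                 (λ p e → FromCycle.successorOf-labelingOf p e)
                 (λ g e → ToCycle.labelingOf-successorOf g (good-sound g (∧-true₁ e)) (∧-true₂ e))
                 (λ p e → cong (_⊙ 1) (monoEq-cong m (FromCycle.labelingOf-monomial p e)))

  -- Step 3: a good labeling with several ν-cycles is paired with the
  -- labeling obtained by exchanging γ and β on the ν-cycle of the first
  -- label outside the cycle of w_s; this keeps the monomial.

  firstOutside : Labeling → Fin k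
  firstOutside g = find (λ w → not (inOrbit (ν g) (ws g) w)) (allFin k) s

  onSwapCycle : Labeling → Fin k → Bool
  onSwapCycle g w = inOrbit (ν g) (firstOutside g) w

  swapCycle : Labeling → Labeling
  swapCycle g = tabulate (λ w → if onSwapCycle g w then swap (lookup g w) else lookup g w)

  swapCycle-lookup : ∀ g w → lookup (swapCycle g) w ≡ (if onSwapCycle g w then swap (lookup g w) else lookup g w)
  swapCycle-lookup g w = VP.lookup∘tabulate _ w

  module SwapCycle (g : Labeling) (gp : IsGood g) (nh : SingleCycle g ≡ false) where
    open GoodPermutations g gp
    open Orbits (ν g) νinj

    νs : Surj (ν g)
    νs = inj→surj (ν g) νinj

    firstOutside-outside : inOrbit (ν g) (ws g) (firstOutside g) ≡ false
    firstOutside-outside with all-false-elim (allFin k) nh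
    ... | w , mw , ew = not-true (find-true (λ w → not (inOrbit (ν g) (ws g) w)) (allFin k) s mw (cong not ew))

    w₀ : Fin k
    w₀ = firstOutside g

    cycle-intro : ∀ j w → iter (ν g) j w₀ ≡ w → onSwapCycle g w ≡ true
    cycle-intro j w e = orb-intro j w₀ w e

    cycle-elim : ∀ w → onSwapCycle g w ≡ true → ∃[ j ] iter (ν g) j w₀ ≡ w
    cycle-elim w e = orb-elim w₀ w e

    cycle-w₀ : onSwapCycle g w₀ ≡ true
    cycle-w₀ = cycle-intro 0 w₀ refl

    cycle-ν : ∀ w → onSwapCycle g w ≡ true → onSwapCycle g (ν g w) ≡ true
    cycle-ν w e = let (j , ej) = cycle-elim w e in cycle-intro (suc j) _ (cong (ν g) ej)

    cycle-ν⁻ : ∀ w → onSwapCycle g (ν g w) ≡ true → onSwapCycle g w ≡ true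
    cycle-ν⁻ w e with cycle-elim _ e | orb-sym 1 w (ν g w) refl
    ... | j , ej | i , ei = cycle-intro (i + j) w (orb-trans j i w₀ (ν g w) w ej ei)

    -- anything in onSwapCycle reaches x0, so ws ∉ onSwapCycle
    -- the cycle of w_s is disjoint from the swap cycle
    ws-never-reaches : ∀ b → onSwapCycle g b ≡ true → ∀ j → iter (ν g) j (ws g) ≢ b
    ws-never-reaches b wb j e with cycle-elim b wb
    ... | i , ei with orb-sym i w₀ b ei
    ... | r , er = t≢f (trans (sym (orb-intro (r + j) (ws g) w₀ (orb-trans j r (ws g) b w₀ e er))) firstOutside-outside)

    ws-off-cycle : onSwapCycle g (ws g) ≡ false
    ws-off-cycle with onSwapCycle g (ws g) in e
    ... | true = ⊥-elim (ws-never-reaches (ws g) e 0 refl)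
    ... | false = refl

    -- arcs on the swap cycle avoid s, where the variables are not symmetric
    γ∉s : ∀ w → onSwapCycle g w ≡ true → γ g w ≢ s
    γ∉s w e eq = t≢f (trans (sym (subst (λ z → onSwapCycle g z ≡ true) (trans (sym (inv-l (γ g) γinj w)) (cong γi eq)) e)) ws-off-cycle)

    β∉s : ∀ w → onSwapCycle g w ≡ true → β g w ≢ s
    β∉s w e eq = γ∉s (ν g w) (cycle-ν w e) (trans (γν w) eq)

    g' : Labeling
    g' = swapCycle g
    -- the swapped labeling g' exchanges γ and β on the cycle (T) and agrees off it (F)
    γ'T : ∀ w → onSwapCycle g w ≡ true → γ g' w ≡ β g w
    γ'T w e rewrite swapCycle-lookup g w | e = refl
    β'T : ∀ w → onSwapCycle g w ≡ true → β g' w ≡ γ g w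
    β'T w e rewrite swapCycle-lookup g w | e = refl
    γ'F : ∀ w → onSwapCycle g w ≡ false → γ g' w ≡ γ g w
    γ'F w e rewrite swapCycle-lookup g w | e = refl
    β'F : ∀ w → onSwapCycle g w ≡ false → β g' w ≡ β g w
    β'F w e rewrite swapCycle-lookup g w | e = refl

    ν-in : ∀ a b → onSwapCycle g a ≡ true → ν g a ≡ b → onSwapCycle g b ≡ true
    ν-in a b e eq = subst (λ z → onSwapCycle g z ≡ true) eq (cycle-ν a e)

    γinj' : Inj (γ g')
    γinj' {a} {b} e with onSwapCycle g a in ea | onSwapCycle g b in eb
    ... | true | true = βinj (trans (sym (γ'T a ea)) (trans e (γ'T b eb)))
    ... | false | false = γinj (trans (sym (γ'F a ea)) (trans e (γ'F b eb)))
    ... | true | false = ⊥-elim (t≢f (trans (sym (ν-in a b ea (γinj (trans (γν a) (trans (sym (γ'T a ea)) (trans e (γ'F b eb))))))) eb))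
    ... | false | true = ⊥-elim (t≢f (trans (sym (ν-in b a eb (γinj (trans (γν b) (trans (sym (γ'T b eb)) (trans (sym e) (γ'F a ea))))))) ea))

    βinj' : Inj (β g')
    βinj' {a} {b} e with onSwapCycle g a in ea | onSwapCycle g b in eb
    ... | true | true = γinj (trans (sym (β'T a ea)) (trans e (β'T b eb)))
    ... | false | false = βinj (trans (sym (β'F a ea)) (trans e (β'F b eb)))
    ... | true | false = ⊥-elim (t≢f (trans (sym (cycle-ν⁻ b (subst (λ z → onSwapCycle g z ≡ true) (sym νb) ea))) eb))
      where
      νb : ν g b ≡ a
      νb = γinj (trans (γν b) (trans (sym (β'F b eb)) (trans (sym e) (β'T a ea))))
    ... | false | true = ⊥-elim (t≢f (trans (sym (cycle-ν⁻ a (subst (λ z → onSwapCycle g z ≡ true) (sym νa) eb))) ea))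
      where
      νa : ν g a ≡ b
      νa = γinj (trans (γν a) (trans (sym (β'F a ea)) (trans e (β'T b eb))))

    swapped-good : IsGood g'
    swapped-good = record { labelsOK = labels-ok ; γinj = γinj' ; βinj = βinj' }
      where
      labels-ok : ∀ w → labelOK g' w ≡ true
      labels-ok w with onSwapCycle g w in e
      ... | true rewrite γ'T w e | β'T w e | adjβ w | adjγ w | finEq-sym (β g w) (γ g w) = ∧-true₂ {a = inN adj (γ g w) (β g w) w} (labelsOK w)
      ... | false rewrite γ'F w e | β'F w e = labelsOK w

    -- x_{u w} x_{w v} = x_{v w} x_{w u} when u, v ≠ s
    swapped-monomial : ∀ y → labelingMonomial g' y ≡ labelingMonomial g y
    swapped-monomial y = ∑-cong (allFin k) same-term
      where
      same-term : ∀ w → labelTerm (lookup g' w) w y ≡ labelTerm (lookup g w) w y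
      same-term w with onSwapCycle g w in e
      ... | false rewrite swapCycle-lookup g w | e = refl
      ... | true rewrite swapCycle-lookup g w | e | finEq-false (γ∉s w e) | finEq-false (β∉s w e) = +-comm (indicator (xIn (β g w) w) y) (indicator (false , γ g w , w) y)

    open GoodPermutations g' swapped-good using () renaming (νinj to νinj')
    module O' = Orbits (ν g') νinj'

    ν'W : ∀ w → onSwapCycle g w ≡ true → ν g' w ≡ inv (ν g) w
    ν'W w e = trans (cong (inv (γ g')) (trans (β'T w e) (sym eγ))) (inv-l (γ g') γinj' v)
      where
      v : Fin k
      v = inv (ν g) w
      νx : ν g v ≡ w
      νx = inv-r (ν g) νs w
      v-on-cycle : onSwapCycle g v ≡ true
      v-on-cycle = cycle-ν⁻ v (subst (λ z → onSwapCycle g z ≡ true) (sym νx) e)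
      eγ : γ g' v ≡ γ g w
      eγ = trans (γ'T v v-on-cycle) (trans (sym (γν v)) (cong (γ g) νx))

    ν'F : ∀ w → onSwapCycle g w ≡ false → ν g' w ≡ ν g w
    ν'F w e = trans (cong (inv (γ g')) (trans (β'F w e) (sym eγ))) (inv-l (γ g') γinj' v)
      where
      v : Fin k
      v = ν g w
      v-off-cycle : onSwapCycle g v ≡ false
      v-off-cycle with onSwapCycle g v in ex
      ... | true = ⊥-elim (t≢f (trans (sym (cycle-ν⁻ w ex)) e))
      ... | false = refl
      eγ : γ g' v ≡ β g w
      eγ = trans (γ'F v v-off-cycle) (γν w)

    same-ws : ws g' ≡ ws g
    same-ws = trans (cong (inv (γ g')) (sym (trans (γ'F (ws g) ws-off-cycle) (inv-r (γ g) γs s)))) (inv-l (γ g') γinj' (ws g))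

    same-ws-orbit : ∀ j → iter (ν g') j (ws g') ≡ iter (ν g) j (ws g)
    same-ws-orbit zero = same-ws
    same-ws-orbit (suc j) = trans (cong (ν g') (same-ws-orbit j)) (ν'F _ nw)
      where
      nw : onSwapCycle g (iter (ν g) j (ws g)) ≡ false
      nw with onSwapCycle g (iter (ν g) j (ws g)) in ew
      ... | true = ⊥-elim (ws-never-reaches _ ew j refl)
      ... | false = refl

    inOrb-same : ∀ w → inOrbit (ν g') (ws g') w ≡ inOrbit (ν g) (ws g) w
    inOrb-same w = any-cong (upTo k) (λ j → cong (λ z → finEq z w) (same-ws-orbit j))

    firstOutside-same : firstOutside g' ≡ w₀
    firstOutside-same = find-cong _ _ (allFin k) s (λ w → cong not (inOrb-same w))

    swapped-not-single : SingleCycle g' ≡ false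
    swapped-not-single = all-false (∈-allFin w₀) (trans (inOrb-same w₀) firstOutside-outside)

    fwd : ∀ j → onSwapCycle g (iter (ν g') j w₀) ≡ true
    fwd zero = cycle-w₀
    fwd (suc j) = cycle-ν⁻ _ (subst (λ z → onSwapCycle g z ≡ true) (sym (trans (cong (ν g) (ν'W _ (fwd j))) (inv-r (ν g) νs _))) (fwd j))

    back : ∀ j → iter (ν g') j (iter (ν g) j w₀) ≡ w₀
    back zero = refl
    back (suc j) = trans (cong (λ z → iter (ν g') z (ν g (iter (ν g) j w₀))) (+-comm 1 j))
                   (trans (O'.it-add j 1 _)
                   (trans (cong (iter (ν g') j) (trans (ν'W _ (cycle-ν _ (cycle-intro j _ refl))) (inv-l (ν g) νinj _)))
                   (back j)))

    onSwapCycle-same : ∀ w → onSwapCycle g' w ≡ onSwapCycle g w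
    onSwapCycle-same w rewrite firstOutside-same = bool-iff forward backward
      where
      forward : inOrbit (ν g') w₀ w ≡ true → onSwapCycle g w ≡ true
      forward e = let (j , ej) = O'.orb-elim w₀ w e in subst (λ z → onSwapCycle g z ≡ true) ej (fwd j)
      backward : onSwapCycle g w ≡ true → inOrbit (ν g') w₀ w ≡ true
      backward e with cycle-elim w e
      ... | j , ej with O'.orb-sym j w w₀ (trans (cong (iter (ν g') j) (sym ej)) (back j))
      ... | i , ei = O'.orb-intro i w₀ w ei

    swapCycle-involutive : swapCycle g' ≡ g
    swapCycle-involutive = trans (VP.tabulate-cong same-arc) (VP.tabulate∘lookup g)
      where
      same-arc : ∀ w → (if onSwapCycle g' w then swap (lookup g' w) else lookup g' w) ≡ lookup g w
      same-arc w rewrite onSwapCycle-same w | swapCycle-lookup g w with onSwapCycle g w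
      ... | true = refl
      ... | false = refl

    swapCycle-moves : swapCycle g ≢ g
    swapCycle-moves e = γβne w₀ (sym (cong proj₁ (trans (sym swapCycle-w₀) (cong (λ z → lookup z w₀) e))))
      where
      swapCycle-w₀ : lookup (swapCycle g) w₀ ≡ swap (lookup g w₀)
      swapCycle-w₀ rewrite swapCycle-lookup g w₀ | cycle-w₀ = refl

  -- Step 4: a good single-cycle labeling is determined by its monomial.

  allVar-complete : (y : Var k) → y ∈ allVar k
  allVar-complete (b , u , w) =
    ∈-concat⁺′ (∈-concat⁺′ (∈-map⁺ (λ w → b , u , w) (∈-allFin w)) (∈-map⁺ (λ u → map (λ w → b , u , w) (allFin k)) (∈-allFin u)))
               (∈-map⁺ (λ b → concatMap (λ u → map (λ w → b , u , w) (allFin k)) (allFin k)) (bool∈ b))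
    where
    bool∈ : (b : Bool) → b ∈ allBool
    bool∈ true = here refl
    bool∈ false = there (here refl)

  indicator-localise : ∀ (b' : Bool) u w (b : Bool) v w₀ →
    indicator (b' , u , w) (b , v , w₀) ≡ finEq w w₀ ⊙ indicator (b' , u , w₀) (b , v , w₀)
  indicator-localise b' u w b v w₀ with finEq w w₀ in e
  ... | true rewrite finEq-refl w₀ = refl
  ... | false rewrite BP.∧-zeroʳ (finEq u v) | BP.∧-zeroʳ ⌊ b' Data.Bool.≟ b ⌋ = refl

  labelTerm-localise : ∀ (a : Arc) w b v w₀ → labelTerm a w (b , v , w₀) ≡ finEq w w₀ ⊙ labelTerm a w₀ (b , v , w₀)
  labelTerm-localise a w b v w₀ with finEq (proj₂ a) s
  ... | true = trans (cong₂ _+_ (indicator-localise false (proj₁ a) w b v w₀) (indicator-localise true (proj₂ a) w b v w₀)) (⊙-+ (finEq w w₀) _ _)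
  ... | false = trans (cong₂ _+_ (indicator-localise false (proj₁ a) w b v w₀) (indicator-localise false (proj₂ a) w b v w₀)) (⊙-+ (finEq w w₀) _ _)

  labelingMonomial-at : ∀ g b v w₀ → labelingMonomial g (b , v , w₀) ≡ labelTerm (lookup g w₀) w₀ (b , v , w₀)
  labelingMonomial-at g b v w₀ =
    trans (∑-cong (allFin k) (λ w → labelTerm-localise (lookup g w) w b v w₀))
          (trans (∑-cong (allFin k) (λ w → cong (λ c → c ⊙ labelTerm (lookup g w) w₀ (b , v , w₀)) (finEq-sym w w₀)))
                 (delta EF w₀ (λ w → labelTerm (lookup g w) w₀ (b , v , w₀))))

  ind : Bool → ℕ
  ind b = b ⊙ 1

  ind-1 : ∀ {b} → ind b ≡ 1 → b ≡ true
  ind-1 {true} _ = refl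

  indicator-same : ∀ (b : Bool) u v w → indicator (b , u , w) (b , v , w) ≡ ind (finEq u v)
  indicator-same b u v w rewrite dec-complete (b Data.Bool.≟ b) refl | finEq-refl w with finEq u v
  ... | true = refl
  ... | false = refl

  degree : Labeling → Fin k → Fin k → ℕ
  degree g v w = labelingMonomial g (false , v , w) + labelingMonomial g (true , v , w)

  degree-value : ∀ g v w → degree g v w ≡ ind (finEq (γ g w) v) + ind (finEq (β g w) v)
  degree-value g v w rewrite labelingMonomial-at g false v w | labelingMonomial-at g true v w with finEq (β g w) s
  ... | true rewrite indicator-same false (γ g w) v w | indicator-same true (β g w) v w =
          cong (_+ ind (finEq (β g w) v)) (+-identityʳ (ind (finEq (γ g w) v)))
  ... | false rewrite indicator-same false (γ g w) v w | indicator-same false (β g w) v w = +-identityʳ _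

  -- at s the variables are not symmetrised: x_{s w} records whether γ w = s
  source-exponent : ∀ g w → labelingMonomial g (false , s , w) ≡ ind (finEq (γ g w) s)
  source-exponent g w rewrite labelingMonomial-at g false s w with finEq (β g w) s in e
  ... | true rewrite indicator-same false (γ g w) s w = +-identityʳ _
  ... | false rewrite indicator-same false (γ g w) s w | indicator-same false (β g w) s w | e = +-identityʳ _

  -- Starting from w_s, equal monomials force g' to follow g around its cycle.
  module Rigidity (g : Labeling) (gp : IsGood g) (single : SingleCycle g ≡ true)
                  (g' : Labeling) (gp' : IsGood g') (me : ∀ y → labelingMonomial g y ≡ labelingMonomial g' y) where
    open GoodPermutations g gp
    open SingleCycleFacts single
    module G' = GoodPermutations g' gp'

    same-degrees : ∀ v w → ind (finEq (γ g w) v) + ind (finEq (β g w) v) ≡ ind (finEq (γ g' w) v) + ind (finEq (β g' w) v)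
    same-degrees v w = trans (sym (degree-value g v w)) (trans (cong₂ _+_ (me (false , v , w)) (me (true , v , w))) (degree-value g' v w))

    start : γ g' (ws g) ≡ γ g (ws g)
    start = trans (finEq-sound (ind-1 (begin
        ind (finEq (γ g' (ws g)) s) ≡⟨ sym (source-exponent g' (ws g)) ⟩
        labelingMonomial g' (false , s , ws g) ≡⟨ sym (me _) ⟩
        labelingMonomial g (false , s , ws g) ≡⟨ source-exponent g (ws g) ⟩
        ind (finEq (γ g (ws g)) s) ≡⟨ cong ind (subst (λ z → finEq z s ≡ true) (sym (inv-r (γ g) γs s)) (finEq-refl s)) ⟩
        1 ∎)))
      (sym (inv-r (γ g) γs s))
      where open ≡-Reasoning

    -- same tail forces same head (the label's degree at β w is 1 in g)
    step-β : ∀ w → γ g' w ≡ γ g w → β g' w ≡ β g w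
    step-β w e with finEq (β g' w) (β g w) in eb
    ... | true = finEq-sound eb
    ... | false = ⊥-elim (1+n≢0 (trans (sym (cong₂ (λ a b → ind a + ind b) (finEq-false (γβne w)) (finEq-refl (β g w))))
                    (trans (same-degrees (β g w) w) (cong₂ (λ a b → ind a + ind b) (trans (cong (λ z → finEq z (β g w)) e) (finEq-false (γβne w))) eb))))

    step-γ : ∀ w → γ g' w ≡ γ g w → γ g' (ν g w) ≡ γ g (ν g w)
    step-γ w e with finEq (γ g' (ν g w)) (β g w) in e1
    ... | true = trans (finEq-sound e1) (sym (γν w))
    ... | false with finEq (β g' (ν g w)) (β g w) in e2
    ... | true = ⊥-elim (γβne w (trans (sym (cong (γ g) ν-fixes)) (γν w)))
      where
      ν-fixes : ν g w ≡ w
      ν-fixes = G'.βinj (trans (finEq-sound e2) (sym (step-β w e)))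
    ... | false = ⊥-elim (1+n≢0 (trans (sym (cong₂ (λ a b → ind a + ind b) (subst (λ z → finEq z (β g w) ≡ true) (sym (γν w)) (finEq-refl _))
                                                                            (finEq-false (λ eq → γβne (ν g w) (trans (γν w) (sym eq))))))
                                 (trans (same-degrees (β g w) (ν g w)) (cong₂ (λ a b → ind a + ind b) e1 e2))))

    along-cycle : ∀ j → γ g' (iter (ν g) j (ws g)) ≡ γ g (iter (ν g) j (ws g))
    along-cycle zero = start
    along-cycle (suc j) = step-γ _ (along-cycle j)

    same : g' ≡ g
    same = trans (sym (VP.tabulate∘lookup g')) (trans (VP.tabulate-cong same-arc) (VP.tabulate∘lookup g))
      where
      same-arc : ∀ w → lookup g' w ≡ lookup g w
      same-arc w with reaches w
      ... | j , _ , refl = cong₂ _,_ (along-cycle j) (step-β _ (along-cycle j))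

  Paired : Monomial (Var k) → Labeling → Bool
  Paired m g = Good g ∧ (not (SingleCycle g) ∧ monoEq m (labelingMonomial g))

  good-split : ∀ m g → Good g ⊙ monoEq m (labelingMonomial g) ⊙ 1
                       ≡ (Good g ∧ SingleCycle g) ⊙ monoEq m (labelingMonomial g) ⊙ 1 + Paired m g ⊙ 1
  good-split m g with Good g | SingleCycle g | monoEq m (labelingMonomial g)
  ... | true | true | true = refl
  ... | true | true | false = refl
  ... | true | false | true = refl
  ... | true | false | false = refl
  ... | false | _ | _ = refl

  paired-even : ∀ m → Σ ℕ (λ n → ∑ (list ELabeling) (λ g → Paired m g ⊙ 1) ≡ n + n)
  paired-even m = involution-count-even ELabeling (Paired m) swapCycle preserved involutive moves
    where
    good : ∀ g → Paired m g ≡ true → IsGood g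
    good g e = good-sound g (∧-true₁ e)
    several : ∀ g → Paired m g ≡ true → SingleCycle g ≡ false
    several g e = not-true (∧-true₁ (∧-true₂ {a = Good g} e))
    monomial : ∀ g → Paired m g ≡ true → monoEq m (labelingMonomial g) ≡ true
    monomial g e = ∧-true₂ {a = not (SingleCycle g)} (∧-true₂ {a = Good g} e)
    preserved : ∀ g → Paired m g ≡ true → Paired m (swapCycle g) ≡ true
    preserved g e = ∧-intro (good-complete _ (SwapCycle.swapped-good g (good g e) (several g e)))
               (∧-intro (cong not (SwapCycle.swapped-not-single g (good g e) (several g e)))
                        (trans (monoEq-cong m (SwapCycle.swapped-monomial g (good g e) (several g e))) (monomial g e)))
    involutive : ∀ g → Paired m g ≡ true → swapCycle (swapCycle g) ≡ g
    involutive g e = SwapCycle.swapCycle-involutive g (good g e) (several g e)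
    moves : ∀ g → Paired m g ≡ true → swapCycle g ≢ g
    moves g e = SwapCycle.swapCycle-moves g (good g e) (several g e)

  hamSum-labelings : ∀ m → cnt m (hamSum adj s) ≡ ∑ (list ELabeling) (λ g → (Good g ∧ SingleCycle g) ⊙ monoEq m (labelingMonomial g) ⊙ 1)
  hamSum-labelings m = trans (hamSum-count m) (cycles-are-labelings m)

  Λ-count-decomposition : ∀ m → Σ ℕ (λ n → cnt m (ΛG adj s) ≡ cnt m (hamSum adj s) + (n + n))
  Λ-count-decomposition m = n , (begin
      cnt m (ΛG adj s) ≡⟨ Λ-count m ⟩
      ∑ (list ELabeling) (λ g → Good g ⊙ monoEq m (labelingMonomial g) ⊙ 1) ≡⟨ ∑-cong (list ELabeling) (good-split m) ⟩
      ∑ (list ELabeling) (λ g → (Good g ∧ SingleCycle g) ⊙ monoEq m (labelingMonomial g) ⊙ 1 + Paired m g ⊙ 1) ≡⟨ ∑-+ (list ELabeling) _ _ ⟩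
      ∑ (list ELabeling) (λ g → (Good g ∧ SingleCycle g) ⊙ monoEq m (labelingMonomial g) ⊙ 1) + ∑ (list ELabeling) (λ g → Paired m g ⊙ 1)
        ≡⟨ cong₂ _+_ (sym (hamSum-labelings m)) (proj₂ (paired-even m)) ⟩
      cnt m (hamSum adj s) + (n + n) ∎)
    where
    open ≡-Reasoning
    n : ℕ
    n = proj₁ (paired-even m)

  coefficients-agree : GF2._≈ₚ_ k (ΛG adj s) (hamSum adj s)
  coefficients-agree m = begin
      cnt m (ΛG adj s) % 2 ≡⟨ cong (_% 2) (proj₂ (Λ-count-decomposition m)) ⟩
      (cnt m (hamSum adj s) + (n + n)) % 2 ≡⟨ cong (λ z → (cnt m (hamSum adj s) + z) % 2) (trans (cong (n +_) (sym (+-identityʳ n))) (*-comm 2 n)) ⟩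
      (cnt m (hamSum adj s) + n * 2) % 2 ≡⟨ [m+kn]%n≡m%n (cnt m (hamSum adj s)) n 2 ⟩
      cnt m (hamSum adj s) % 2 ∎
    where
    open ≡-Reasoning
    n : ℕ
    n = proj₁ (Λ-count-decomposition m)

  single-monomial-count : (p : Successor) → isHam adj s (successor p) ≡ true →
                          cnt (labelingMonomial (labelingOf p)) (hamSum adj s) ≡ 1
  single-monomial-count p eh = trans (hamSum-labelings m₀) (trans (∑-cong (list ELabeling) indicatorOf) (uniq ELabeling g₀))
    where
    g₀ : Labeling
    g₀ = labelingOf p
    m₀ : Monomial (Var k)
    m₀ = labelingMonomial g₀
    selected : ∀ g → ((Good g ∧ SingleCycle g) ∧ monoEq m₀ (labelingMonomial g)) ≡ eq ELabeling g₀ g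
    selected g = bool-iff forward backward
      where
      forward : ((Good g ∧ SingleCycle g) ∧ monoEq m₀ (labelingMonomial g)) ≡ true → eq ELabeling g₀ g ≡ true
      forward e = subst (λ z → eq ELabeling g₀ z ≡ true)
        (sym (Rigidity.same g₀ (FromCycle.labelingOf-good p eh) (FromCycle.labelingOf-single p eh) g
               (good-sound g (∧-true₁ (∧-true₁ {a = Good g ∧ SingleCycle g} e)))
               (monoEq-sound allVar-complete m₀ (labelingMonomial g) (∧-true₂ {a = Good g ∧ SingleCycle g} e))))
        (eq-refl ELabeling g₀)
      backward : eq ELabeling g₀ g ≡ true → ((Good g ∧ SingleCycle g) ∧ monoEq m₀ (labelingMonomial g)) ≡ true
      backward e = subst (λ z → ((Good z ∧ SingleCycle z) ∧ monoEq m₀ (labelingMonomial z)) ≡ true) (eq-sound ELabeling {g₀} {g} e)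
        (∧-intro (∧-intro (good-complete g₀ (FromCycle.labelingOf-good p eh)) (FromCycle.labelingOf-single p eh)) (monoEq-refl m₀))
    indicatorOf : ∀ g → (Good g ∧ SingleCycle g) ⊙ monoEq m₀ (labelingMonomial g) ⊙ 1 ≡ eq ELabeling g₀ g ⊙ 1
    indicatorOf g = trans (sym (⊙-∧ (Good g ∧ SingleCycle g) (monoEq m₀ (labelingMonomial g)) 1)) (cong (_⊙ 1) (selected g))

  isHam-cong : (σ σ' : Vtx k → Vtx k) → (∀ v → σ v ≡ σ' v) → isHam adj s σ ≡ isHam adj s σ'
  isHam-cong σ σ' e = cong ((3 ≤ᵇ (k + k)) ∧_) (cong₂ _∧_ (all-cong (allVtx k) (λ v → cong (edge adj v) (e v)))
                        (cong₂ _∧_ (all-cong (allVtx k) (λ v → any-cong (upTo (k + k)) (λ i → cong (λ z → vtxEq z v) (iter-cong i (inj₁ s)))))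
                                   (cong (λ z → vtxEq z (inj₁ s)) (iter-cong (k + k) (inj₁ s)))))
    where
    iter-cong : ∀ i a → iter σ i a ≡ iter σ' i a
    iter-cong zero a = refl
    iter-cong (suc i) a = trans (cong σ (iter-cong i a)) (e _)

  hamiltonian-monomial : ∀ σ → σ ∈ hc adj s → Σ (Monomial (Var k)) (λ m → GF2.coeff k m (hamSum adj s) ≡ 1)
  hamiltonian-monomial σ σ∈hc = labelingMonomial (labelingOf p) , cong (_% 2) (single-monomial-count p ham)
    where
    p : Successor
    p = tabulate (λ u → σ (inj₁ u)) , tabulate (λ w → σ (inj₂ w))
    same-map : ∀ v → successor p v ≡ σ v
    same-map (inj₁ u) = VP.lookup∘tabulate (λ u → σ (inj₁ u)) u
    same-map (inj₂ w) = VP.lookup∘tabulate (λ w → σ (inj₂ w)) w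
    ham : isHam adj s (successor p) ≡ true
    ham = trans (isHam-cong (successor p) σ same-map) (filter-true (isHam adj s) (allVtxFuns k) σ∈hc)

  no-cycles-zero : hc adj s ≡ [] → GF2._≈ₚ_ k (ΛG adj s) (GF2.0ₚ k)
  no-cycles-zero e m = trans (coefficients-agree m)
    (cong (λ l → GF2.coeff k m (Σₚ l (λ σ → Πₚ (allVtx k) (λ v → x s v (σ v))))) e)

lemma5 : (k : ℕ) (adj : Fin k → Fin k → Bool) (s : Fin k) →
    GF2._≈ₚ_ k (ΛG adj s) (hamSum adj s)
    × (GF2._≈ₚ_ k (ΛG adj s) (GF2.0ₚ k) ⇔ hc adj s ≡ [])
lemma5 k adj s = coefficients-agree , mk⇔ zero-no-cycles no-cycles-zero
  where
  open Setting k adj s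
  -- a Hamiltonian cycle would give a monomial of coefficient 1 in Λ
  zero-no-cycles : GF2._≈ₚ_ k (ΛG adj s) (GF2.0ₚ k) → hc adj s ≡ []
  zero-no-cycles Λ≈0 = no-cycle (hc adj s) refl
    where
    no-cycle : (l : List (Vtx k → Vtx k)) → hc adj s ≡ l → l ≡ []
    no-cycle [] _ = refl
    no-cycle (σ ∷ _) e = ⊥-elim (1+n≢0 (trans (sym (proj₂ witness)) (trans (sym (coefficients-agree m)) (Λ≈0 m))))
      where
      witness : Σ (Monomial (Var k)) (λ m → GF2.coeff k m (hamSum adj s) ≡ 1)
      witness = hamiltonian-monomial σ (subst (σ ∈_) (sym e) (here refl))
      m : Monomial (Var k)
      m = proj₁ witness
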